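{- Let $n\geq 5$, $k\ge 4$, and let $\tau=\tau_1\cdots\tau_{k-2}21\in S_k$ be a pattern with $\tau_{k-1}=2$, $\tau_k=1$. Then for each $3\leq j\leq n$, $$\left|\mathcal{A}_n(\tau,4321;213)\big|_2^j\right|=a_{j-1}(\tau,4321;213).$$
   Context: A permutation $\pi$ of $[n]=\{1,\dots,n\}$ is cyclic if it consists of a single $n$-cycle. Its one-line notation is $\pi_1\pi_2\cdots\pi_n$ with $\pi_i=\pi(i)$. Its standard cycle form is $(c_1,c_2,\dots,c_n)$ with $c_1=1$ and $c_{i+1}=\pi(c_i)$ for $1\le i<n$. A sequence $w_1\cdots w_n$ of distinct integers contains a pattern $\sigma=\sigma_1\cdots\sigma_k\in S_k$ if there are indices $i_1<\dots<i_k$ with $w_{i_s}>w_{i_t}$ iff $\sigma_s>\sigma_t$ for all $s<t$; otherwise it avoids $\sigma$. $\mathcal{A}_n(\sigma_1,\dots,\sigma_l;\rho)$ is the set of cyclic permutations of $[n]$ whose one-line notation avoids each $\sigma_i$ and whose standard cycle form $c_1\cdots c_n$, read as a sequence, avoids $\rho$; $a_n(\sigma_1,\dots,\sigma_l;\rho)$ is its cardinality. For $2\le j\le n$, $\mathcal{A}_n(\sigma_1,\dots,\sigma_l;\rho)\big|_2^j$ denotes the set of $\pi\in\mathcal{A}_n(\sigma_1,\dots,\sigma_l;\rho)$ whose standard cycle form $(c_1,\dots,c_n)$ has $c_j=2$. -}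

module Defs where

open import Data.Bool using (Bool; true; false; _∧_; _∨_; not; T)
open import Data.Nat using (ℕ; zero; suc; _<ᵇ_; _≡ᵇ_)
open import Data.Fin using (Fin; toℕ)
open import Data.Vec using (Vec; lookup)
open import Data.List using (List; []; _∷_; map; length)
open import Data.Bool.ListAction using (all; any)
open import Data.Product using (Σ)

-- Sequences of distinct positive integers are represented as List ℕ.

_==_ : Bool → Bool → Bool
true  == b = b
false == b = not b

notIn : ℕ → List ℕ → Bool
notIn x []       = true
notIn x (y ∷ ys) = not (x ≡ᵇ y) ∧ notIn x ys

distinct : List ℕ → Bool
distinct []       = true
distinct (x ∷ xs) = notIn x xs ∧ distinct xs

-- sameOrder as bs : the two sequences have the same length and are
-- order-isomorphic:  a_s > a_t  iff  b_s > b_t  for all s < t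
sameOrder : List ℕ → List ℕ → Bool
sameOrder []       []       = true
sameOrder []       (_ ∷ _)  = false
sameOrder (_ ∷ _)  []       = false
sameOrder (a ∷ as) (b ∷ bs) = firstOK as bs ∧ sameOrder as bs
  where
  firstOK : List ℕ → List ℕ → Bool
  firstOK (a' ∷ as') (b' ∷ bs') = ((a' <ᵇ a) == (b' <ᵇ b)) ∧ firstOK as' bs'
  firstOK _ _ = true

subseqs : ℕ → List ℕ → List (List ℕ)
subseqs zero    _        = [] ∷ []
subseqs (suc k) []       = []
subseqs (suc k) (x ∷ xs) = Data.List._++_ (map (x ∷_) (subseqs k xs)) (subseqs (suc k) xs)

contains : List ℕ → List ℕ → Bool
contains w σ = any (sameOrder σ) (subseqs (length σ) w)

avoids : List ℕ → List ℕ → Bool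
avoids w σ = not (contains w σ)

-- A candidate permutation of [n] is a map [n] → [n] given by its table
-- (position i ∈ Fin n ↦ value); we use 0-based Fin internally and
-- shift by one to get the values 1..n.
Table : ℕ → Set
Table n = Vec (Fin n) n

oneLine : ∀ {n} → Table n → List ℕ
oneLine v = Data.List.map (λ x → suc (toℕ x)) (Data.Vec.toList v)

orbit : ∀ {n} → (Fin n → Fin n) → ℕ → Fin n → List ℕ
orbit f zero    x = []
orbit f (suc k) x = suc (toℕ x) ∷ orbit f k (f x)

-- standard cycle form (c₁,…,cₙ) with c₁ = 1, c_{i+1} = π(c_i)
cycleForm : ∀ {n} → Table n → List ℕ
cycleForm {zero}  v = []
cycleForm {suc n} v = orbit (lookup v) (suc n) Data.Fin.zero

-- π is a permutation (one-line notation has distinct entries) and is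
-- cyclic (a single n-cycle: the orbit of 1 consists of n distinct elements)
isCyclicPerm : ∀ {n} → Table n → Bool
isCyclicPerm v = distinct (oneLine v) ∧ distinct (cycleForm v)

inA : ∀ {n} → List (List ℕ) → List ℕ → Table n → Bool
inA σs ρ v = isCyclicPerm v ∧ all (avoids (oneLine v)) σs ∧ avoids (cycleForm v) ρ

-- j-th entry (1-based) of a list
nth : List ℕ → ℕ → ℕ
nth []       _             = 0
nth (x ∷ xs) zero          = 0
nth (x ∷ xs) (suc zero)    = x
nth (x ∷ xs) (suc (suc j)) = nth xs (suc j)

A : ℕ → List (List ℕ) → List ℕ → Set
A n σs ρ = Σ (Table n) (λ v → T (inA σs ρ v))

A∣ : ℕ → List (List ℕ) → List ℕ → ℕ → Set
A∣ n σs ρ j = Σ (Table n) (λ v → T (inA σs ρ v ∧ (nth (cycleForm v) j ≡ᵇ 2)))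

{-# OPTIONS --safe #-}

-- Write A_n for A_n(4321;213). The patterns of length 4 ending in 21 are 3421 and 4321, and τ
-- ends with one of them, so A_n(τ,4321;213) = A_n as soon as every π ∈ A_n avoids 3421 too.
-- If c_j = 2 with j ≥ 3, avoiding 213 in the cycle form puts every entry after 2 below every
-- entry strictly between 1 and 2, and avoiding 4321 then forces the cycle to be
-- (1, c_2, …, c_{j-1}, 2, 3, …, n-j+2). Deleting the run 2, …, n-j+2 and standardising is a
-- bijection A_n|_2^j → A_{j-1}, inverse to inserting the run, and it reflects occurrences of
-- 3421 and 4321. If instead π(1) = 2, merging the points 1 and 2 lands in A_{n-1} and also
-- reflects them, so 3421-avoidance follows by induction on n.

module Submission where

open import Defs
open import Data.Bool using (Bool; true; false; _∧_; not; T)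
open import Data.Bool.Properties using (T-∧; T-irrelevant)
open import Data.Empty using (⊥; ⊥-elim)
open import Data.Fin using (Fin; zero; suc; toℕ; fromℕ<; punchOut; splitAt; _↑ˡ_; _↑ʳ_)
import Data.Fin.Properties as Fin
open import Data.List using (List; []; _∷_; _++_; map; length; upTo)
import Data.List as List
import Data.List.Properties as List
open import Data.List.Membership.Propositional using (_∈_; _∉_; find; lose)
open import Data.List.Membership.Propositional.Properties using (∈-++⁺ˡ; ∈-++⁺ʳ; ∈-++⁻; ∈-map⁺; ∈-map⁻)
open import Data.List.Relation.Binary.Permutation.Propositional using (_↭_; ↭⇒↭ₛ; ↭-sym)
import Data.List.Relation.Binary.Permutation.Propositional.Properties as PermutationP
import Data.List.Relation.Binary.Permutation.Setoid.Properties as PermutationₛP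
open import Data.List.Relation.Binary.Sublist.Propositional
  using (_⊆_; []; _∷_; _∷ʳ_; minimum; ⊆-refl; ⊆-trans; ⊆-reflexive; to∈)
open import Data.List.Relation.Binary.Sublist.Propositional.Properties
  using (map⁺; ∷ˡ⁻; All-resp-⊆; ++⁺ˡ; ++⁺ʳ; drop⁺-≥)
open import Data.List.Relation.Unary.All as All using (All; []; _∷_)
import Data.List.Relation.Unary.All.Properties as AllP
open import Data.List.Relation.Unary.AllPairs as AllPairs using (AllPairs; []; _∷_)
open import Data.List.Relation.Unary.Any using (here; there)
open import Data.List.Relation.Unary.Any.Properties using (any⁺; any⁻)
open import Data.List.Relation.Unary.Linked using (Linked; []; [-]; _∷_)
open import Data.List.Relation.Unary.Linked.Properties using (Linked⇒AllPairs)
open import Data.List.Relation.Unary.Unique.Propositional using (Unique)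
import Data.List.Relation.Unary.Unique.Propositional.Properties as UniqueP
open import Data.Nat using (ℕ; zero; suc; _+_; _∸_; _≤_; _<_; z≤n; s≤s; z<s; s<s⁻¹; s≤s⁻¹; _<ᵇ_; _≡ᵇ_; _<?_)
open import Data.Nat.GeneralisedArithmetic using (iterate)
open import Data.Nat.Induction using (<-rec)
open import Data.Nat.Properties
open import Data.Product using (Σ; ∃; ∃-syntax; _×_; _,_; proj₁; proj₂)
open import Data.Sum using (_⊎_; inj₁; inj₂; [_,_]′)
open import Data.Vec using (Vec; []; _∷_; lookup; toList)
import Data.Vec as Vec
import Data.Vec.Properties as VecP
import Data.Vec.Relation.Unary.All.Properties as VecAll
import Data.Vec.Relation.Unary.AllPairs as VecAllPairs
import Data.Vec.Relation.Unary.Unique.Propositional as VecUnique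
import Data.Vec.Relation.Unary.Unique.Propositional.Properties as VecUniqueP
open import Function.Base using (_∘_; id; case_of_)
open import Function.Bundles using (Equivalence; _⇔_; mk⇔; _↔_; mk↔ₛ′)
open import Relation.Binary.Core using (_Preserves_⟶_)
open import Relation.Binary.Definitions using (tri<; tri≈; tri>)
open import Relation.Binary.PropositionalEquality
  using (_≡_; _≢_; refl; sym; trans; cong; cong₂; subst; subst₂; module ≡-Reasoning)
import Relation.Binary.PropositionalEquality as ≡
open import Relation.Nullary using (¬_; contradiction; yes; no)

open Equivalence using (to; from)

_&_ : ∀ {x y} → T x → T y → T (x ∧ y)
p & q = from T-∧ (p , q)

T-not⇒¬T : ∀ {x} → T (not x) → ¬ T x
T-not⇒¬T {false} _ ()

¬T⇒T-not : ∀ {x} → ¬ T x → T (not x)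
¬T⇒T-not {false} _ = _
¬T⇒T-not {true}  h = h _

T-== : ∀ {x y} → T x → T (x == y) → T y
T-== {true} _ h = h

<ᵇ⇔ : ∀ {m n} → T (m <ᵇ n) ⇔ m < n
<ᵇ⇔ = mk⇔ (<ᵇ⇒< _ _) <⇒<ᵇ

≮ᵇ⇔ : ∀ {m n} → T (not (m <ᵇ n)) ⇔ n ≤ m
≮ᵇ⇔ = mk⇔ (λ h → ≮⇒≥ (T-not⇒¬T h ∘ <⇒<ᵇ)) (λ n≤m → ¬T⇒T-not (≤⇒≯ n≤m ∘ <ᵇ⇒< _ _))

∈-subseqs : ∀ {s w : List ℕ} → s ⊆ w → s ∈ subseqs (length s) w
∈-subseqs {[]}    _          = here refl
∈-subseqs {x ∷ s} (y ∷ʳ s⊆w) = ∈-++⁺ʳ (map (y ∷_) (subseqs (length s) _)) (∈-subseqs s⊆w)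
∈-subseqs {x ∷ s} (refl ∷ s⊆w) = ∈-++⁺ˡ (∈-map⁺ (x ∷_) (∈-subseqs s⊆w))

subseqs-⊆ : ∀ k (w : List ℕ) {s} → s ∈ subseqs k w → s ⊆ w
subseqs-⊆ zero    w       (here refl) = minimum w
subseqs-⊆ (suc k) (x ∷ w) s∈ with ∈-++⁻ (map (x ∷_) (subseqs k w)) s∈
... | inj₂ s∈rest = x ∷ʳ subseqs-⊆ (suc k) w s∈rest
... | inj₁ s∈init with ∈-map⁻ (x ∷_) s∈init
...   | s′ , s′∈ , refl = refl ∷ subseqs-⊆ k w s′∈

sameOrder-length : ∀ σ s → T (sameOrder σ s) → length s ≡ length σ
sameOrder-length []      []      _  = refl
sameOrder-length (a ∷ σ) (b ∷ s) so = cong suc (sameOrder-length σ s (proj₂ (to T-∧ so)))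

contains⇒ : ∀ w σ → T (contains w σ) → ∃[ s ] s ⊆ w × T (sameOrder σ s)
contains⇒ w σ h with find (any⁻ (sameOrder σ) _ h)
... | s , s∈ , so = s , subseqs-⊆ (length σ) w s∈ , so

⇒contains : ∀ {w σ s} → s ⊆ w → T (sameOrder σ s) → T (contains w σ)
⇒contains {w} {σ} {s} s⊆w so =
  any⁺ (sameOrder σ) (lose (subst (λ k → s ∈ subseqs k w) (sameOrder-length σ s so) (∈-subseqs s⊆w)) so)

sameOrder³⇒ : ∀ p q r a b c → T (sameOrder (p ∷ q ∷ r ∷ []) (a ∷ b ∷ c ∷ [])) →
              T ((q <ᵇ p) == (b <ᵇ a)) × T ((r <ᵇ p) == (c <ᵇ a))
sameOrder³⇒ _ _ _ _ _ _ so =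
  let (pa , _) = to T-∧ so; (q~b , pa′) = to T-∧ pa; (r~c , _) = to T-∧ pa′
  in q~b , r~c

sameOrder⁴⇒ : ∀ p q r t a b c d → T (sameOrder (p ∷ q ∷ r ∷ t ∷ []) (a ∷ b ∷ c ∷ d ∷ [])) →
              T ((q <ᵇ p) == (b <ᵇ a)) × T ((r <ᵇ p) == (c <ᵇ a)) ×
              T ((r <ᵇ q) == (c <ᵇ b)) × T ((t <ᵇ r) == (d <ᵇ c))
sameOrder⁴⇒ _ _ _ _ _ _ _ _ so =
  let (pa , qrt) = to T-∧ so; (q~b , pa′) = to T-∧ pa; (r~c , _) = to T-∧ pa′
      (qb , rt) = to T-∧ qrt; (r~c′ , _) = to T-∧ qb; (rc , _) = to T-∧ rt; (t~d , _) = to T-∧ rc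
  in q~b , r~c , r~c′ , t~d

length≡4 : ∀ (s : List ℕ) → length s ≡ 4 → ∃[ a ] ∃[ b ] ∃[ c ] ∃[ d ] s ≡ a ∷ b ∷ c ∷ d ∷ []
length≡4 (a ∷ b ∷ c ∷ d ∷ []) refl = a , b , c , d , refl

length≡3 : ∀ (s : List ℕ) → length s ≡ 3 → ∃[ a ] ∃[ b ] ∃[ c ] s ≡ a ∷ b ∷ c ∷ []
length≡3 (a ∷ b ∷ c ∷ []) refl = a , b , c , refl

-- Has··21 w: w contains 3421 or 4321, the patterns of length 4 ending in 21.
Has4321 Has··21 : List ℕ → Set
Has4321 w = ∃[ a ] ∃[ b ] ∃[ c ] ∃[ d ] (a ∷ b ∷ c ∷ d ∷ []) ⊆ w × b < a × c < b × d < c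
Has··21 w = ∃[ a ] ∃[ b ] ∃[ c ] ∃[ d ] (a ∷ b ∷ c ∷ d ∷ []) ⊆ w × c < a × c < b × d < c

Has213 : List ℕ → Set
Has213 w = ∃[ a ] ∃[ b ] ∃[ c ] (a ∷ b ∷ c ∷ []) ⊆ w × b < a × a ≤ c

Has213-⊆ : ∀ {w w′} → w ⊆ w′ → Has213 w → Has213 w′
Has213-⊆ w⊆w′ (a , b , c , s⊆w , b<a , a≤c) = a , b , c , ⊆-trans s⊆w w⊆w′ , b<a , a≤c

contains4321⇔ : ∀ w → T (contains w (4 ∷ 3 ∷ 2 ∷ 1 ∷ [])) ⇔ Has4321 w
contains4321⇔ w = mk⇔ decode encode
  where
  decode : T (contains w (4 ∷ 3 ∷ 2 ∷ 1 ∷ [])) → Has4321 w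
  decode h with s , s⊆w , so ← contains⇒ w (4 ∷ 3 ∷ 2 ∷ 1 ∷ []) h
          with a , b , c , d , refl ← length≡4 s (sameOrder-length _ s so)
    with b~a , _ , c~b , d~c ← sameOrder⁴⇒ 4 3 2 1 a b c d so
    = a , b , c , d , s⊆w , to <ᵇ⇔ b~a , to <ᵇ⇔ c~b , to <ᵇ⇔ d~c
  encode : Has4321 w → T (contains w (4 ∷ 3 ∷ 2 ∷ 1 ∷ []))
  encode (a , b , c , d , s⊆w , b<a , c<b , d<c) = ⇒contains s⊆w
    ((from <ᵇ⇔ b<a & (from <ᵇ⇔ c<a & (from <ᵇ⇔ (<-trans d<c c<a) & _)))
     & ((from <ᵇ⇔ c<b & (from <ᵇ⇔ (<-trans d<c c<b) & _)) & ((from <ᵇ⇔ d<c & _) & _)))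
    where
    c<a : c < a
    c<a = <-trans c<b b<a

contains213⇔ : ∀ w → T (contains w (2 ∷ 1 ∷ 3 ∷ [])) ⇔ Has213 w
contains213⇔ w = mk⇔ decode encode
  where
  decode : T (contains w (2 ∷ 1 ∷ 3 ∷ [])) → Has213 w
  decode h with s , s⊆w , so ← contains⇒ w (2 ∷ 1 ∷ 3 ∷ []) h
          with a , b , c , refl ← length≡3 s (sameOrder-length _ s so)
    with b~a , c~a ← sameOrder³⇒ 2 1 3 a b c so
    = a , b , c , s⊆w , to <ᵇ⇔ b~a , to ≮ᵇ⇔ c~a
  encode : Has213 w → T (contains w (2 ∷ 1 ∷ 3 ∷ []))
  encode (a , b , c , s⊆w , b<a , a≤c) = ⇒contains s⊆w
    ((from <ᵇ⇔ b<a & (from ≮ᵇ⇔ a≤c & _)) & ((from ≮ᵇ⇔ (≤-trans (<⇒≤ b<a) a≤c) & _) & _))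

sameOrder-++⁻ : ∀ pre σ s → T (sameOrder (pre ++ σ) s) → ∃[ s′ ] s′ ⊆ s × T (sameOrder σ s′)
sameOrder-++⁻ []        σ s       so = s , ⊆-refl , so
sameOrder-++⁻ (a ∷ pre) σ (b ∷ s) so with s′ , s′⊆s , so′ ← sameOrder-++⁻ pre σ s (proj₂ (to T-∧ so)) =
  s′ , b ∷ʳ s′⊆s , so′

EndsIn··21 : List ℕ → Set
EndsIn··21 τ = ∃[ pre ] ∃[ t₁ ] ∃[ t₂ ] τ ≡ pre ++ t₁ ∷ t₂ ∷ 2 ∷ 1 ∷ [] × 2 < t₁ × 2 < t₂

contains-··21 : ∀ {τ} → EndsIn··21 τ → ∀ w → T (contains w τ) → Has··21 w
contains-··21 (pre , t₁ , t₂ , refl , 2<t₁ , 2<t₂) w h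
  with s , s⊆w , so ← contains⇒ w (pre ++ t₁ ∷ t₂ ∷ 2 ∷ 1 ∷ []) h
  with s′ , s′⊆s , so′ ← sameOrder-++⁻ pre (t₁ ∷ t₂ ∷ 2 ∷ 1 ∷ []) s so
  with a , b , c , d , refl ← length≡4 s′ (sameOrder-length _ s′ so′)
  with _ , c~a , c~b , d~c ← sameOrder⁴⇒ t₁ t₂ 2 1 a b c d so′
  = a , b , c , d , ⊆-trans s′⊆s s⊆w
  , to <ᵇ⇔ (T-== (from <ᵇ⇔ 2<t₁) c~a) , to <ᵇ⇔ (T-== (from <ᵇ⇔ 2<t₂) c~b) , to <ᵇ⇔ d~c

⊆-map⁻ : ∀ (g : ℕ → ℕ) (w : List ℕ) {s} → s ⊆ map g w → ∃[ s₀ ] s₀ ⊆ w × s ≡ map g s₀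
⊆-map⁻ g []      []         = [] , [] , refl
⊆-map⁻ g (x ∷ w) (_ ∷ʳ s⊆)  with s₀ , s₀⊆ , refl ← ⊆-map⁻ g w s⊆ = s₀ , x ∷ʳ s₀⊆ , refl
⊆-map⁻ g (x ∷ w) (refl ∷ s⊆) with s₀ , s₀⊆ , refl ← ⊆-map⁻ g w s⊆ = x ∷ s₀ , refl ∷ s₀⊆ , refl

⊆-++⁻ : ∀ (xs : List ℕ) {ys s} → s ⊆ xs ++ ys → ∃[ s₁ ] ∃[ s₂ ] s ≡ s₁ ++ s₂ × s₁ ⊆ xs × s₂ ⊆ ys
⊆-++⁻ []       s⊆ = [] , _ , refl , [] , s⊆
⊆-++⁻ (x ∷ xs) (_ ∷ʳ s⊆) with s₁ , s₂ , refl , s₁⊆ , s₂⊆ ← ⊆-++⁻ xs s⊆ = s₁ , s₂ , refl , x ∷ʳ s₁⊆ , s₂⊆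
⊆-++⁻ (x ∷ xs) (refl ∷ s⊆) with s₁ , s₂ , refl , s₁⊆ , s₂⊆ ← ⊆-++⁻ xs s⊆ = x ∷ s₁ , s₂ , refl , refl ∷ s₁⊆ , s₂⊆

AllPairs-⊆ : ∀ {R : ℕ → ℕ → Set} {x y ys xs} → AllPairs R xs → (x ∷ y ∷ ys) ⊆ xs → R x y
AllPairs-⊆ (_ ∷ rest)   (_ ∷ʳ p)    = AllPairs-⊆ rest p
AllPairs-⊆ (x~ ∷ _)     (refl ∷ p)  = All.lookup x~ (to∈ p)

module OrderEmbedding {g : ℕ → ℕ} (g-mono : g Preserves _<_ ⟶ _<_) where

  preserves-≤ : ∀ {x y} → x ≤ y → g x ≤ g y
  preserves-≤ x≤y with m≤n⇒m<n∨m≡n x≤y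
  ... | inj₁ x<y  = <⇒≤ (g-mono x<y)
  ... | inj₂ refl = ≤-refl

  reflects-< : ∀ {x y} → g x < g y → x < y
  reflects-< gx<gy = ≰⇒> (λ y≤x → <⇒≱ gx<gy (preserves-≤ y≤x))

  reflects-≤ : ∀ {x y} → g x ≤ g y → x ≤ y
  reflects-≤ gx≤gy = ≮⇒≥ (λ y<x → <⇒≱ (g-mono y<x) gx≤gy)

  injective : ∀ {x y} → g x ≡ g y → x ≡ y
  injective e = ≤-antisym (reflects-≤ (≤-reflexive e)) (reflects-≤ (≤-reflexive (sym e)))

  Has4321-map : ∀ {w w′} → map g w ⊆ w′ → Has4321 w → Has4321 w′
  Has4321-map gw⊆w′ (a , b , c , d , s⊆w , b<a , c<b , d<c) =
    g a , g b , g c , g d , ⊆-trans (map⁺ g s⊆w) gw⊆w′ , g-mono b<a , g-mono c<b , g-mono d<c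

  Has213-map : ∀ {w w′} → map g w ⊆ w′ → Has213 w → Has213 w′
  Has213-map gw⊆w′ (a , b , c , s⊆w , b<a , a≤c) =
    g a , g b , g c , ⊆-trans (map⁺ g s⊆w) gw⊆w′ , g-mono b<a , preserves-≤ a≤c

  Has4321-map⁻ : ∀ w → Has4321 (map g w) → Has4321 w
  Has4321-map⁻ w (_ , _ , _ , _ , s⊆gw , b<a , c<b , d<c)
    with a ∷ b ∷ c ∷ d ∷ [] , s⊆w , refl ← ⊆-map⁻ g w s⊆gw
    = a , b , c , d , s⊆w , reflects-< b<a , reflects-< c<b , reflects-< d<c

  Has··21-map⁻ : ∀ w → Has··21 (map g w) → Has··21 w
  Has··21-map⁻ w (_ , _ , _ , _ , s⊆gw , c<a , c<b , d<c)
    with a ∷ b ∷ c ∷ d ∷ [] , s⊆w , refl ← ⊆-map⁻ g w s⊆gw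
    = a , b , c , d , s⊆w , reflects-< c<a , reflects-< c<b , reflects-< d<c

  Has213-map⁻ : ∀ w → Has213 (map g w) → Has213 w
  Has213-map⁻ w (_ , _ , _ , s⊆gw , b<a , a≤c)
    with a ∷ b ∷ c ∷ [] , s⊆w , refl ← ⊆-map⁻ g w s⊆gw
    = a , b , c , s⊆w , reflects-< b<a , reflects-≤ a≤c

-- The shape of oneLine (insertRun w) = x ∷ R ++ 1 ∷ L below: the run R = 3, …, d+2 is
-- increasing, 1 lies below L, and 2 is the only entry of L below an entry of R.
module RunRemoval {R L : List ℕ} {e z : ℕ}
                  (R-increasing : AllPairs _<_ R)
                  (below-R-is-z : ∀ {r y} → r ∈ R → y ∈ L → y < r → y ≡ z)
                  (e<L : All (e <_) L) where

  private
    no-descent-after : ∀ {r c d} → r ∈ R → (c ∷ d ∷ []) ⊆ e ∷ L → c < r → d < c → ⊥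
    no-descent-after r∈R (refl ∷ d⊆L) c<r d<c = <-asym d<c (All.lookup e<L (to∈ d⊆L))
    no-descent-after r∈R (_ ∷ʳ cd⊆L) c<r d<c =
      <-irrefl (trans (below-R-is-z r∈R (to∈ (∷ˡ⁻ cd⊆L)) (<-trans d<c c<r)) (sym (below-R-is-z r∈R (to∈ cd⊆L) c<r))) d<c

  321⊆L : ∀ {b c d} → (b ∷ c ∷ d ∷ []) ⊆ R ++ e ∷ L → c < b → d < c → (b ∷ c ∷ d ∷ []) ⊆ L
  321⊆L bcd⊆ c<b d<c with ⊆-++⁻ R bcd⊆
  ... | [] , _ , refl , _ , (_ ∷ʳ bcd⊆L)  = bcd⊆L
  ... | [] , _ , refl , _ , (refl ∷ cd⊆L) = contradiction (All.lookup e<L (to∈ cd⊆L)) (<-asym c<b)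
  ... | _ ∷ [] , _ , refl , b⊆R , cd⊆ = ⊥-elim (no-descent-after (to∈ b⊆R) cd⊆ c<b d<c)
  ... | _ ∷ _ ∷ [] , _ , refl , bc⊆R , _ = contradiction (AllPairs-⊆ R-increasing bc⊆R) (<-asym c<b)
  ... | _ ∷ _ ∷ _ ∷ [] , _ , refl , bcd⊆R , _ = contradiction (AllPairs-⊆ R-increasing bcd⊆R) (<-asym c<b)

  ··21⊆x∷L : ∀ x {a b c d} → (a ∷ b ∷ c ∷ d ∷ []) ⊆ x ∷ R ++ e ∷ L → c < a → c < b → d < c →
             (a ∷ b ∷ c ∷ d ∷ []) ⊆ x ∷ L
  ··21⊆x∷L x (refl ∷ bcd⊆) _ c<b d<c = refl ∷ 321⊆L bcd⊆ c<b d<c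
  ··21⊆x∷L x (_ ∷ʳ abcd⊆) c<a c<b d<c with ⊆-++⁻ R abcd⊆
  ... | [] , _ , refl , _ , (_ ∷ʳ abcd⊆L)  = x ∷ʳ abcd⊆L
  ... | [] , _ , refl , _ , (refl ∷ bcd⊆L) = contradiction (All.lookup e<L (to∈ (∷ˡ⁻ bcd⊆L))) (<-asym c<a)
  ... | _ ∷ [] , _ , refl , a⊆R , bcd⊆ = ⊥-elim (no-descent-after (to∈ a⊆R) (∷ˡ⁻ bcd⊆) c<a d<c)
  ... | _ ∷ _ ∷ [] , _ , refl , ab⊆R , cd⊆ = ⊥-elim (no-descent-after (to∈ ab⊆R) cd⊆ c<a d<c)
  ... | _ ∷ _ ∷ _ ∷ [] , _ , refl , abc⊆R , _ =
    contradiction (AllPairs-⊆ R-increasing (∷ˡ⁻ abc⊆R)) (<-asym c<b)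
  ... | _ ∷ _ ∷ _ ∷ _ ∷ [] , _ , refl , abcd⊆R , _ =
    contradiction (AllPairs-⊆ R-increasing (∷ˡ⁻ abcd⊆R)) (<-asym c<b)

  Has4321-remove : ∀ x → Has4321 (x ∷ R ++ e ∷ L) → Has4321 (x ∷ L)
  Has4321-remove x (a , b , c , d , s⊆ , b<a , c<b , d<c) =
    a , b , c , d , ··21⊆x∷L x s⊆ (<-trans c<b b<a) c<b d<c , b<a , c<b , d<c

  Has··21-remove : ∀ x → Has··21 (x ∷ R ++ e ∷ L) → Has··21 (x ∷ L)
  Has··21-remove x (a , b , c , d , s⊆ , c<a , c<b , d<c) =
    a , b , c , d , ··21⊆x∷L x s⊆ c<a c<b d<c , c<a , c<b , d<c

-- The shape of cycleForm (insertRun w) = 1 ∷ M ++ (2, …, d+2) below.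
Has213-remove : ∀ {h M I} → AllPairs _<_ I → (∀ {y z} → y ∈ M → z ∈ I → z < y) → All (h <_) (M ++ I) →
                Has213 (h ∷ M ++ I) → Has213 M
Has213-remove I↑ I<M h< (a , b , c , refl ∷ bc⊆ , b<a , a≤c) = contradiction (All.lookup h< (to∈ bc⊆)) (<-asym b<a)
Has213-remove {M = M} I↑ I<M h< (a , b , c , _ ∷ʳ abc⊆ , b<a , a≤c) with ⊆-++⁻ M abc⊆
... | [] , _ , refl , _ , abc⊆I = contradiction (AllPairs-⊆ I↑ abc⊆I) (<-asym b<a)
... | _ ∷ [] , _ , refl , a⊆M , bc⊆I = contradiction a≤c (<⇒≱ (I<M (to∈ a⊆M) (to∈ (∷ˡ⁻ bc⊆I))))
... | _ ∷ _ ∷ [] , _ , refl , ab⊆M , c⊆I = contradiction a≤c (<⇒≱ (I<M (to∈ ab⊆M) (to∈ c⊆I)))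
... | _ ∷ _ ∷ _ ∷ [] , _ , refl , abc⊆M , _ = a , b , c , abc⊆M , b<a , a≤c

notIn⇔ : ∀ x xs → T (notIn x xs) ⇔ All (x ≢_) xs
notIn⇔ x []       = mk⇔ (λ _ → []) (λ _ → _)
notIn⇔ x (y ∷ ys) = mk⇔
  (λ h → let (x≢ᵇy , x∉ys) = to T-∧ h in (T-not⇒¬T x≢ᵇy ∘ ≡⇒≡ᵇ x y) ∷ to (notIn⇔ x ys) x∉ys)
  (λ { (x≢y ∷ x∉ys) → ¬T⇒T-not (x≢y ∘ ≡ᵇ⇒≡ x y) & from (notIn⇔ x ys) x∉ys })

distinct⇔Unique : ∀ xs → T (distinct xs) ⇔ Unique xs
distinct⇔Unique []       = mk⇔ (λ _ → []) (λ _ → _)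
distinct⇔Unique (x ∷ xs) = mk⇔
  (λ h → let (x∉xs , u) = to T-∧ h in to (notIn⇔ x xs) x∉xs ∷ to (distinct⇔Unique xs) u)
  (λ { (x∉xs ∷ u) → from (notIn⇔ x xs) x∉xs & from (distinct⇔Unique xs) u })

Unique-⊆ : ∀ {xs ys : List ℕ} → xs ⊆ ys → Unique ys → Unique xs
Unique-⊆ []          _           = []
Unique-⊆ (_ ∷ʳ xs⊆)  (_ ∷ u)     = Unique-⊆ xs⊆ u
Unique-⊆ (refl ∷ xs⊆) (x∉ ∷ u)   = All-resp-⊆ xs⊆ x∉ ∷ Unique-⊆ xs⊆ u

Unique-insert : ∀ {x : ℕ} {L} M → Unique (x ∷ L) → Unique M → (∀ {y} → y ∈ M → y ∉ x ∷ L) → Unique (x ∷ M ++ L)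
Unique-insert M (x∉L ∷ uL) uM M∩xL=∅ =
  AllP.++⁺ (All.tabulate (λ y∈M x≡y → M∩xL=∅ y∈M (here (sym x≡y)))) x∉L
  ∷ UniqueP.++⁺ uM uL (λ (y∈M , y∈L) → M∩xL=∅ y∈M (there y∈L))

Unique-toList⁻ : ∀ {A : Set} {k} {v : Vec A k} → Unique (toList v) → VecUnique.Unique v
Unique-toList⁻ {v = []}    []        = VecAllPairs.[]
Unique-toList⁻ {v = x ∷ v} (x∉ ∷ u) = VecAll.toList⁻ x∉ VecAllPairs.∷ Unique-toList⁻ u

injective⇒surjective : ∀ {k} (g : Fin k → Fin k) → (∀ {i j} → g i ≡ g j → i ≡ j) → ∀ y → ∃[ i ] g i ≡ y
injective⇒surjective {suc k} g g-injective y with Fin.any? (λ i → g i Fin.≟ y)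
... | yes found = found
... | no ∄      = contradiction (Fin.injective⇒≤ punchOut-injective′) (<-irrefl refl)
  where
  avoid : Fin (suc k) → Fin k
  avoid i = punchOut {i = y} (λ y≡gi → ∄ (i , sym y≡gi))
  punchOut-injective′ : ∀ {i j} → avoid i ≡ avoid j → i ≡ j
  punchOut-injective′ e = g-injective (Fin.punchOut-injective {i = y} _ _ e)

module _ {k} (f : Fin k → Fin k) where

  iterate-suc : ∀ x i → iterate f x (suc i) ≡ f (iterate f x i)
  iterate-suc x zero    = refl
  iterate-suc x (suc i) = iterate-suc (f x) i

  iterate-+ : ∀ x i j → iterate f x (i + j) ≡ iterate f (iterate f x i) j
  iterate-+ x zero    j = refl
  iterate-+ x (suc i) j = iterate-+ (f x) i j

  orbit-+ : ∀ x i j → orbit f (i + j) x ≡ orbit f i x ++ orbit f j (iterate f x i)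
  orbit-+ x zero    j = refl
  orbit-+ x (suc i) j = cong (suc (toℕ x) ∷_) (orbit-+ (f x) i j)

  length-orbit : ∀ x i → length (orbit f i x) ≡ i
  length-orbit x zero    = refl
  length-orbit x (suc i) = cong suc (length-orbit (f x) i)

  ∈-orbit : ∀ x {i l} → i < l → suc (toℕ (iterate f x i)) ∈ orbit f l x
  ∈-orbit x {zero}  {suc l} _         = here refl
  ∈-orbit x {suc i} {suc l} (s≤s i<l) = there (∈-orbit (f x) i<l)

  nth-orbit : ∀ x {i l} → i < l → nth (orbit f l x) (suc i) ≡ suc (toℕ (iterate f x i))
  nth-orbit x {zero}  {suc l} _         = refl
  nth-orbit x {suc i} {suc l} (s≤s i<l) = nth-orbit (f x) i<l

  iterate-injective : ∀ x {i j l} → Unique (orbit f l x) → i < l → j < l →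
                      iterate f x i ≡ iterate f x j → i ≡ j
  iterate-injective x {zero}  {zero}  _ _ _ _ = refl
  iterate-injective x {zero}  {suc j} {suc l} (x∉ ∷ _) _ (s≤s j<l) e =
    contradiction (cong (suc ∘ toℕ) e) (All.lookup x∉ (∈-orbit (f x) j<l))
  iterate-injective x {suc i} {zero}  {suc l} (x∉ ∷ _) (s≤s i<l) _ e =
    contradiction (cong (suc ∘ toℕ) (sym e)) (All.lookup x∉ (∈-orbit (f x) i<l))
  iterate-injective x {suc i} {suc j} {suc l} (_ ∷ u) (s≤s i<l) (s≤s j<l) e =
    cong suc (iterate-injective (f x) u i<l j<l e)

first-zero : ∀ {k} (f : Fin (suc k) → Fin (suc k)) x {l} → 1 ∈ orbit f l x →
             ∃[ r ] r < l × iterate f x r ≡ zero × 1 ∉ orbit f r x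
first-zero f zero    {suc l} _           = 0 , z<s , refl , λ ()
first-zero f (suc x) {suc l} (here ())
first-zero f (suc x) {suc l} (there 1∈) with r , r<l , e , 1∉ ← first-zero f (f (suc x)) 1∈ =
  suc r , s≤s r<l , e , λ { (here ()) ; (there 1∈′) → 1∉ 1∈′ }

0∉orbit : ∀ {k} (f : Fin k → Fin k) l x → 0 ∉ orbit f l x
0∉orbit f (suc l) x (there 0∈) = 0∉orbit f l (f x) 0∈

-- nth is 1-based: nth l (suc i) is the entry at index i.
nth∷⊆drop : ∀ (l : List ℕ) i {s} → i < length l → s ⊆ List.drop (suc i) l → (nth l (suc i) ∷ s) ⊆ List.drop i l
nth∷⊆drop (x ∷ l) zero    _         s⊆ = refl ∷ s⊆
nth∷⊆drop (x ∷ l) (suc i) (s≤s i<l) s⊆ = nth∷⊆drop l i i<l s⊆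

entries-⊆ : ∀ (l : List ℕ) (e : ℕ → ℕ) → (∀ {i} → i < length l → nth l (suc i) ≡ e i) →
            ∀ {k} is → AllPairs _<_ is → All (k ≤_) is → All (_< length l) is → map e is ⊆ List.drop k l
entries-⊆ l e e≡ []       _          _         _            = minimum _
entries-⊆ l e e≡ (i ∷ is) (i< ∷ is↑) (k≤i ∷ _) (i<l ∷ is<l) =
  ⊆-trans (subst (λ x → (x ∷ map e is) ⊆ List.drop i l) (e≡ i<l) (nth∷⊆drop l i i<l (entries-⊆ l e e≡ is is↑ i< is<l)))
          (drop⁺-≥ k≤i)

orbit-entries-⊆ : ∀ {k} (f : Fin k → Fin k) x {l} is → Linked _<_ is → All (_< l) is →
                  map (λ i → suc (toℕ (iterate f x i))) is ⊆ orbit f l x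
orbit-entries-⊆ f x {l} is is↑ is<l =
  entries-⊆ (orbit f l x) _ (λ i< → nth-orbit f x (subst (_ <_) (length-orbit f x l) i<)) is
            (Linked⇒AllPairs <-trans is↑) (All.tabulate λ _ → z≤n)
            (All.map (λ {i} i<l → subst (i <_) (sym (length-orbit f x l)) i<l) is<l)

values : ∀ {k l} → Vec (Fin k) l → List ℕ
values v = map (suc ∘ toℕ) (toList v)

values-++ : ∀ {k a b} (xs : Vec (Fin k) a) (ys : Vec (Fin k) b) → values (xs Vec.++ ys) ≡ values xs ++ values ys
values-++ []       ys = refl
values-++ (x ∷ xs) ys = cong (suc (toℕ x) ∷_) (values-++ xs ys)

values-map : ∀ {k k′ l} {h : Fin k → Fin k′} {g : ℕ → ℕ} → (∀ x → suc (toℕ (h x)) ≡ g (suc (toℕ x))) →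
             (v : Vec (Fin k) l) → values (Vec.map h v) ≡ map g (values v)
values-map h~g []      = refl
values-map h~g (x ∷ v) = cong₂ _∷_ (h~g x) (values-map h~g v)

values-tabulate : ∀ {k l} s (h : Fin l → Fin k) → (∀ t → suc (toℕ (h t)) ≡ s + toℕ t) →
                  values (Vec.tabulate h) ≡ List.iterate suc s l
values-tabulate {l = zero}  s h h~ = refl
values-tabulate {l = suc l} s h h~ = cong₂ _∷_ (trans (h~ zero) (+-identityʳ s))
  (values-tabulate (suc s) (h ∘ suc) (λ t → trans (h~ (suc t)) (+-suc s (toℕ t))))

0∉values : ∀ {k l} (v : Vec (Fin k) l) → 0 ∉ values v
0∉values (x ∷ v) (here ())
0∉values (x ∷ v) (there 0∈) = 0∉values v 0∈

nth-values : ∀ {k l} (v : Vec (Fin k) l) i → nth (values v) (suc (toℕ i)) ≡ suc (toℕ (lookup v i))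
nth-values (x ∷ v) zero    = refl
nth-values (x ∷ v) (suc i) = nth-values v i

values-entries-⊆ : ∀ {k l} (v : Vec (Fin k) l) (ps : List (Fin l)) → Linked _<_ (map toℕ ps) →
                   map (λ p → suc (toℕ (lookup v p))) ps ⊆ values v
values-entries-⊆ {l = l} v ps ps↑ =
  subst (_⊆ values v) (trans (sym (List.map-∘ ps)) (List.map-cong (nth-values v) ps))
    (entries-⊆ (values v) _ (λ _ → refl) (map toℕ ps) (Linked⇒AllPairs <-trans ps↑) (All.tabulate λ _ → z≤n)
               (All.tabulate λ {i} i∈ → case ∈-map⁻ toℕ i∈ of λ (p , _ , i≡) →
                  subst (_< length (values v)) (sym i≡) (subst (toℕ p <_) (sym length-values) (Fin.toℕ<n p))))
  where
  length-values : length (values v) ≡ l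
  length-values = trans (List.length-map _ (toList v)) (VecP.length-toList v)

∈-iterate-suc : ∀ {s k y} → y ∈ List.iterate suc s k → s ≤ y × y < s + k
∈-iterate-suc {s} {suc k} (here refl) = ≤-refl , m<m+n s z<s
∈-iterate-suc {s} {suc k} {y} (there y∈) with s<y , y<s+k ← ∈-iterate-suc y∈ =
  <⇒≤ s<y , subst (y <_) (sym (+-suc s k)) y<s+k

iterate-suc-increasing : ∀ s k → AllPairs _<_ (List.iterate suc s k)
iterate-suc-increasing s zero    = []
iterate-suc-increasing s (suc k) =
  All.tabulate (λ y∈ → proj₁ (∈-iterate-suc y∈)) ∷ iterate-suc-increasing (suc s) k

iterate-suc-unique : ∀ s k → Unique (List.iterate suc s k)
iterate-suc-unique s k = AllPairs.map <⇒≢ (iterate-suc-increasing s k)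

record IsCyclic {k} (π : Table k) : Set where
  field
    oneLine-unique   : Unique (oneLine π)
    cycleForm-unique : Unique (cycleForm π)

isCyclicPerm⇔ : ∀ {k} (π : Table k) → T (isCyclicPerm π) ⇔ IsCyclic π
isCyclicPerm⇔ π = mk⇔
  (λ h → let (u₁ , u₂) = to T-∧ h
         in record { oneLine-unique = to (distinct⇔Unique _) u₁ ; cycleForm-unique = to (distinct⇔Unique _) u₂ })
  (λ c → from (distinct⇔Unique _) (IsCyclic.oneLine-unique c) & from (distinct⇔Unique _) (IsCyclic.cycleForm-unique c))

module Cyclic {k} {π : Table (suc k)} (cyclic : IsCyclic π) where
  open IsCyclic cyclic

  f : Fin (suc k) → Fin (suc k)
  f = lookup π

  -- y i is the entry c_{i+1} of the cycle form, as a 0-based point.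
  y : ℕ → Fin (suc k)
  y = iterate f zero

  f-injective : ∀ {i j} → f i ≡ f j → i ≡ j
  f-injective = VecUniqueP.lookup-injective (Unique-toList⁻ (UniqueP.map⁻ oneLine-unique)) _ _

  1∉cycle-tail : 1 ∉ orbit f k (f zero)
  1∉cycle-tail = UniqueP.Unique[x∷xs]⇒x∉xs cycleForm-unique

  y-injective : ∀ {i j} → i < suc k → j < suc k → y i ≡ y j → i ≡ j
  y-injective = iterate-injective f zero cycleForm-unique

  y-surjective : ∀ x → ∃[ i ] i < suc k × y i ≡ x
  y-surjective x with i , yi≡x ← injective⇒surjective (y ∘ toℕ)
                                   (λ e → Fin.toℕ-injective (y-injective (Fin.toℕ<n _) (Fin.toℕ<n _) e)) x
    = toℕ i , Fin.toℕ<n i , yi≡x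

  y-closes : y (suc k) ≡ zero
  y-closes with y-surjective (y (suc k))
  ... | zero  , _ , y₀≡ = sym y₀≡
  ... | suc i , 1+i<1+k , e = ⊥-elim (<-irrefl (cong suc i≡k) 1+i<1+k)
    where
    i≡k : i ≡ k
    i≡k = y-injective (<-trans (n<1+n i) 1+i<1+k) ≤-refl
            (f-injective (trans (sym (iterate-suc f zero i)) (trans e (iterate-suc f zero k))))

record Admissible {k} (π : Table k) : Set where
  field
    cyclic               : IsCyclic π
    oneLine-avoids-4321  : ¬ Has4321 (oneLine π)
    cycleForm-avoids-213 : ¬ Has213 (cycleForm π)

-- Inserting a run into the cycle

data SplitView (a b : ℕ) : Fin (a + b) → Set where
  left  : (t : Fin a) → SplitView a b (t ↑ˡ b)
  right : (r : Fin b) → SplitView a b (a ↑ʳ r)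

splitView : ∀ a b (q : Fin (a + b)) → SplitView a b q
splitView zero    b q       = right q
splitView (suc a) b zero    = left zero
splitView (suc a) b (suc q) with splitView a b q
... | left t  = left (suc t)
... | right r = right r

restrict : ∀ d {m} → Fin (suc d + suc m) → Fin (suc m)
restrict d x = [ (λ _ → zero) , id ]′ (splitAt (suc d) x)

restrict-1 : ∀ d {m} .(1<n : 1 < suc d + suc m) → restrict d (fromℕ< 1<n) ≡ zero
restrict-1 zero    _ = refl
restrict-1 (suc d) _ = refl

-- insertRun turns the cycle (1, c_2, …, c_{m+1}) into (1, c_2+d+1, …, c_{m+1}+d+1, 2, 3, …, d+2).
-- Table entries are 0-based; liftPoint and liftValue act on the 1-based entries of cycleForm
-- and oneLine.
module Insertion (m d : ℕ) where

  N : ℕ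
  N = suc (d + suc m)

  N≡ : N ≡ suc m + suc d
  N≡ = cong suc (trans (+-comm d (suc m)) (sym (+-suc m d)))

  m+1<N : suc m < N
  m+1<N = s≤s (m≤n+m (suc m) d)

  1<N : 1 < N
  1<N = s≤s (≤-trans (s≤s z≤n) (m<m+n d z<s))

  one : Fin N
  one = fromℕ< 1<N

  embedPoint embedValue : Fin (suc m) → Fin N
  embedPoint zero    = zero
  embedPoint (suc i) = suc d ↑ʳ suc i
  embedValue zero    = one
  embedValue (suc i) = embedPoint (suc i)

  2+t<N : ∀ (t : Fin d) → 2 + toℕ t < N
  2+t<N t = s≤s (≤-trans (s≤s (Fin.toℕ<n t)) (m<m+n d z<s))

  runValue : Fin d → Fin N
  runValue t = fromℕ< (2+t<N t)

  insertRun : Table (suc m) → Table N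
  insertRun (w₀ ∷ ws) = embedValue w₀ ∷ (Vec.tabulate runValue Vec.++ zero ∷ Vec.map embedValue ws)

  deleteRun : Table N → Table (suc m)
  deleteRun π = Vec.tabulate (restrict d ∘ lookup π ∘ embedPoint)

  restrict-embedValue : ∀ y → restrict d (embedValue y) ≡ y
  restrict-embedValue zero    = restrict-1 d 1<N
  restrict-embedValue (suc i) = cong [ _ , id ]′ (Fin.splitAt-↑ʳ (suc d) (suc m) (suc i))

  liftPoint liftValue : ℕ → ℕ
  liftPoint (suc (suc y)) = suc (suc (d + suc y))
  liftPoint y             = y
  liftValue (suc zero)    = 2
  liftValue y             = liftPoint y

  toℕ-one : toℕ one ≡ 1
  toℕ-one = Fin.toℕ-fromℕ< 1<N

  toℕ-embedPoint : ∀ i → suc (toℕ (embedPoint i)) ≡ liftPoint (suc (toℕ i))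
  toℕ-embedPoint zero    = refl
  toℕ-embedPoint (suc i) = cong suc (Fin.toℕ-↑ʳ (suc d) (suc i))

  toℕ-embedValue : ∀ i → suc (toℕ (embedValue i)) ≡ liftValue (suc (toℕ i))
  toℕ-embedValue zero    = cong suc toℕ-one
  toℕ-embedValue (suc i) = toℕ-embedPoint (suc i)

  liftPoint-mono : liftPoint Preserves _<_ ⟶ _<_
  liftPoint-mono {zero}        {suc zero}    _ = z<s
  liftPoint-mono {zero}        {suc (suc y)} _ = z<s
  liftPoint-mono {suc zero}    {suc zero}    (s≤s ())
  liftPoint-mono {suc zero}    {suc (suc y)} _ = s≤s (s≤s z≤n)
  liftPoint-mono {suc (suc x)} {suc (suc y)} (s≤s (s≤s x<y)) = s≤s (s≤s (+-monoʳ-< d (s≤s x<y)))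

  liftValue-mono : liftValue Preserves _<_ ⟶ _<_
  liftValue-mono {zero}        {suc zero}    _ = z<s
  liftValue-mono {zero}        {suc (suc y)} _ = z<s
  liftValue-mono {suc zero}    {suc zero}    (s≤s ())
  liftValue-mono {suc zero}    {suc (suc y)} _ = s≤s (s≤s (≤-trans (s≤s z≤n) (m<m+n d z<s)))
  liftValue-mono {suc (suc x)} {suc zero}    (s≤s ())
  liftValue-mono {suc (suc x)} {suc (suc y)} x<y = liftPoint-mono x<y

  lookup-insertRun-embedPoint : ∀ w i → lookup (insertRun w) (embedPoint i) ≡ embedValue (lookup w i)
  lookup-insertRun-embedPoint (w₀ ∷ ws) zero    = refl
  lookup-insertRun-embedPoint (w₀ ∷ ws) (suc i) =
    trans (VecP.lookup-++ʳ (Vec.tabulate runValue) (zero ∷ Vec.map embedValue ws) (suc i)) (VecP.lookup-map i embedValue ws)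

  runPoint : Fin d → Fin N
  runPoint t = suc (t ↑ˡ suc m)

  gapPoint : Fin N
  gapPoint = suc (d ↑ʳ zero)

  lookup-insertRun-runPoint : ∀ w t → lookup (insertRun w) (runPoint t) ≡ runValue t
  lookup-insertRun-runPoint (w₀ ∷ ws) t =
    trans (VecP.lookup-++ˡ (Vec.tabulate runValue) _ t) (VecP.lookup∘tabulate runValue t)

  lookup-insertRun-gapPoint : ∀ w → lookup (insertRun w) gapPoint ≡ zero
  lookup-insertRun-gapPoint (w₀ ∷ ws) = VecP.lookup-++ʳ (Vec.tabulate runValue) (zero ∷ Vec.map embedValue ws) zero

  toℕ-runValue : ∀ t → toℕ (runValue t) ≡ 2 + toℕ t
  toℕ-runValue t = Fin.toℕ-fromℕ< (2+t<N t)

  toℕ≡suc⇒runPoint : ∀ {p s} → toℕ p ≡ suc s → (s<d : s < d) → p ≡ runPoint (fromℕ< s<d)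
  toℕ≡suc⇒runPoint p≡ s<d = Fin.toℕ-injective
    (trans p≡ (cong suc (sym (trans (Fin.toℕ-↑ˡ (fromℕ< s<d) _) (Fin.toℕ-fromℕ< s<d)))))

  toℕ≡suc⇒gapPoint : ∀ {p} → toℕ p ≡ suc d → p ≡ gapPoint
  toℕ≡suc⇒gapPoint p≡ = Fin.toℕ-injective (trans p≡ (cong suc (sym (trans (Fin.toℕ-↑ʳ d zero) (+-identityʳ d)))))

  module _ (w : Table (suc m)) where

    private
      f : Fin (suc m) → Fin (suc m)
      f = lookup w
      g : Fin N → Fin N
      g = lookup (insertRun w)

      g-run : ∀ p s → toℕ p ≡ suc s → s < d → toℕ (g p) ≡ 2 + s
      g-run p s p≡ s<d rewrite toℕ≡suc⇒runPoint p≡ s<d =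
        trans (cong toℕ (lookup-insertRun-runPoint w _)) (trans (toℕ-runValue _) (cong (2 +_) (Fin.toℕ-fromℕ< s<d)))

      g-gap : ∀ p → toℕ p ≡ suc d → g p ≡ zero
      g-gap p p≡ rewrite toℕ≡suc⇒gapPoint p≡ = lookup-insertRun-gapPoint w

    run-orbit : ∀ t s p → toℕ p ≡ suc s → s + t ≤ d → orbit g (suc t) p ≡ List.iterate suc (2 + s) (suc t)
    run-orbit zero    s p p≡ _    = cong (λ z → suc z ∷ []) p≡
    run-orbit (suc t) s p p≡ s+t≤d = cong₂ _∷_ (cong suc p≡)
      (run-orbit t (suc s) (g p) (g-run p s p≡ (<-≤-trans (m<m+n s z<s) s+t≤d)) (subst (_≤ d) (+-suc s t) s+t≤d))

    run-iterate : ∀ t s p → toℕ p ≡ suc s → s + t ≤ d → toℕ (iterate g p t) ≡ suc (s + t)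
    run-iterate zero    s p p≡ _     = trans p≡ (cong suc (sym (+-identityʳ s)))
    run-iterate (suc t) s p p≡ s+t≤d = trans
      (run-iterate t (suc s) (g p) (g-run p s p≡ (<-≤-trans (m<m+n s z<s) s+t≤d)) (subst (_≤ d) (+-suc s t) s+t≤d))
      (cong suc (sym (+-suc s t)))

    run-returns : iterate g one (suc d) ≡ zero
    run-returns = trans (iterate-suc g one d) (g-gap _ (run-iterate d 0 one toℕ-one ≤-refl))

    private
      embedValue≡embedPoint : ∀ k {i} → 1 ∉ orbit f (suc k) i → embedValue i ≡ embedPoint i
      embedValue≡embedPoint k {zero}  1∉ = contradiction (here refl) 1∉
      embedValue≡embedPoint k {suc i} _  = refl

    orbit-insertRun : ∀ k i → 1 ∉ orbit f k (f i) → orbit g (suc k) (embedPoint i) ≡ map liftPoint (orbit f (suc k) i)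
    orbit-insertRun zero    i _  = cong (_∷ []) (toℕ-embedPoint i)
    orbit-insertRun (suc k) i 1∉ = cong₂ _∷_ (toℕ-embedPoint i)
      (trans (cong (orbit g (suc k)) (trans (lookup-insertRun-embedPoint w i) (embedValue≡embedPoint k 1∉)))
             (orbit-insertRun k (f i) (1∉ ∘ there)))

    iterate-insertRun : ∀ k i → 1 ∉ orbit f k (f i) → iterate g (embedPoint i) (suc k) ≡ embedValue (iterate f i (suc k))
    iterate-insertRun zero    i _  = lookup-insertRun-embedPoint w i
    iterate-insertRun (suc k) i 1∉ =
      trans (cong (λ x → iterate g x (suc k)) (trans (lookup-insertRun-embedPoint w i) (embedValue≡embedPoint k 1∉)))
            (iterate-insertRun k (f i) (1∉ ∘ there))

    cycleForm-split : cycleForm (insertRun w) ≡ orbit g (suc m) zero ++ orbit g (suc d) (iterate g zero (suc m))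
    cycleForm-split = trans (cong (λ l → orbit g l zero) N≡) (orbit-+ g zero (suc m) (suc d))

    cycle-reaches-one : IsCyclic w → iterate g zero (suc m) ≡ one
    cycle-reaches-one cyc =
      trans (iterate-insertRun m zero (Cyclic.1∉cycle-tail cyc)) (cong embedValue (Cyclic.y-closes cyc))

    cycleForm-insertRun : IsCyclic w → cycleForm (insertRun w) ≡ map liftPoint (cycleForm w) ++ List.iterate suc 2 (suc d)
    cycleForm-insertRun cyc =
      begin
        cycleForm (insertRun w)
          ≡⟨ cycleForm-split ⟩
        orbit g (suc m) zero ++ orbit g (suc d) (iterate g zero (suc m))
          ≡⟨ cong₂ _++_ (orbit-insertRun m zero (Cyclic.1∉cycle-tail cyc)) (cong (orbit g (suc d)) (cycle-reaches-one cyc)) ⟩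
        map liftPoint (cycleForm w) ++ orbit g (suc d) one
          ≡⟨ cong (map liftPoint (cycleForm w) ++_) (run-orbit d 0 one toℕ-one ≤-refl) ⟩
        map liftPoint (cycleForm w) ++ List.iterate suc 2 (suc d)
          ∎
      where open ≡-Reasoning

    returns-late : IsCyclic (insertRun w) → 1 ∉ orbit f m (f zero)
    returns-late cyc 1∈ with r , r<m , returns , 1∉ ← first-zero f (f zero) 1∈ =
      contradiction (Cyclic.y-injective cyc r+d<N z<s returns-early) λ ()
      where
      r+d<N : suc r + suc d < N
      r+d<N = subst (suc r + suc d <_) (sym N≡) (s≤s (+-monoˡ-< (suc d) r<m))
      returns-early : iterate g zero (suc r + suc d) ≡ zero
      returns-early =
        begin
          iterate g zero (suc r + suc d)                ≡⟨ iterate-+ g zero (suc r) (suc d) ⟩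
          iterate g (iterate g zero (suc r)) (suc d)    ≡⟨ cong (λ x → iterate g x (suc d)) (iterate-insertRun r zero 1∉) ⟩
          iterate g (embedValue (iterate f zero (suc r))) (suc d) ≡⟨ cong (λ x → iterate g (embedValue x) (suc d)) returns ⟩
          iterate g one (suc d)                         ≡⟨ run-returns ⟩
          zero                                          ∎
        where open ≡-Reasoning

    cycleForm-⊆ : IsCyclic (insertRun w) → map liftPoint (cycleForm w) ⊆ cycleForm (insertRun w)
    cycleForm-⊆ cyc = ⊆-trans (⊆-reflexive (sym (orbit-insertRun m zero (returns-late cyc))))
                               (⊆-trans (++⁺ʳ _ ⊆-refl) (⊆-reflexive (sym cycleForm-split)))

    nth-cycleForm-insertRun : IsCyclic w → nth (cycleForm (insertRun w)) (suc (suc m)) ≡ 2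
    nth-cycleForm-insertRun cyc =
      trans (nth-orbit g zero m+1<N)
            (cong suc (trans (cong toℕ (cycle-reaches-one cyc)) toℕ-one))

  oneLine-insertRun : ∀ w₀ ws → oneLine (insertRun (w₀ ∷ ws)) ≡
                      liftValue (suc (toℕ w₀)) ∷ List.iterate suc 3 d ++ 1 ∷ map liftValue (values ws)
  oneLine-insertRun w₀ ws = cong₂ _∷_ (toℕ-embedValue w₀)
    (trans (values-++ (Vec.tabulate runValue) (zero ∷ Vec.map embedValue ws))
           (cong₂ _++_ (values-tabulate 3 runValue (λ t → cong suc (Fin.toℕ-fromℕ< (2+t<N t))))
                       (cong (1 ∷_) (values-map toℕ-embedValue ws))))

  oneLine-⊆ : ∀ w → map liftValue (oneLine w) ⊆ oneLine (insertRun w)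
  oneLine-⊆ (w₀ ∷ ws) =
    ⊆-trans (refl ∷ ++⁺ˡ (List.iterate suc 3 d) (1 ∷ʳ ⊆-refl)) (⊆-reflexive (sym (oneLine-insertRun w₀ ws)))

  liftValue-range : ∀ {y} → y ≢ 0 → liftValue y ≡ 2 ⊎ 3 + d ≤ liftValue y
  liftValue-range {zero}        0≢0 = contradiction refl 0≢0
  liftValue-range {suc zero}    _   = inj₁ refl
  liftValue-range {suc (suc y)} _   = inj₂ (s≤s (s≤s (m<m+n d z<s)))

  liftPoint-large : ∀ {y} → 2 ≤ y → 3 + d ≤ liftPoint y
  liftPoint-large {suc zero}    (s≤s ())
  liftPoint-large {suc (suc y)} _ = s≤s (s≤s (m<m+n d z<s))

  lifted-values-range : ∀ {k} (v : Vec (Fin (suc m)) k) {y} → y ∈ map liftValue (values v) → y ≡ 2 ⊎ 3 + d ≤ y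
  lifted-values-range v y∈ with x , x∈ , refl ← ∈-map⁻ liftValue y∈ = liftValue-range {x} (λ { refl → 0∉values v x∈ })

  lifted-below-run-is-2 : ∀ {k} (v : Vec (Fin (suc m)) k) {r y} → r ∈ List.iterate suc 3 d →
                          y ∈ map liftValue (values v) → y < r → y ≡ 2
  lifted-below-run-is-2 v r∈ y∈ y<r with lifted-values-range v y∈
  ... | inj₁ y≡2    = y≡2
  ... | inj₂ 3+d≤y = contradiction (<-trans y<r (proj₂ (∈-iterate-suc r∈))) (≤⇒≯ 3+d≤y)

  1<lifted : ∀ {k} (v : Vec (Fin (suc m)) k) → All (1 <_) (map liftValue (values v))
  1<lifted v = All.tabulate λ y∈ → case lifted-values-range v y∈ of λ where
    (inj₁ refl)   → s≤s (s≤s z≤n)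
    (inj₂ 3+d≤y) → ≤-trans (s≤s (s≤s z≤n)) 3+d≤y

  module OneLineRemoval (ws : Vec (Fin (suc m)) m) =
    RunRemoval (iterate-suc-increasing 3 d) (lifted-below-run-is-2 ws) (1<lifted ws)

  Has··21-insertRun⁻ : ∀ w → Has··21 (oneLine (insertRun w)) → Has··21 (oneLine w)
  Has··21-insertRun⁻ (w₀ ∷ ws) =
    OrderEmbedding.Has··21-map⁻ liftValue-mono _ ∘ OneLineRemoval.Has··21-remove ws _
    ∘ subst Has··21 (oneLine-insertRun w₀ ws)

  Has4321-insertRun⁻ : ∀ w → Has4321 (oneLine (insertRun w)) → Has4321 (oneLine w)
  Has4321-insertRun⁻ (w₀ ∷ ws) =
    OrderEmbedding.Has4321-map⁻ liftValue-mono _ ∘ OneLineRemoval.Has4321-remove ws _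
    ∘ subst Has4321 (oneLine-insertRun w₀ ws)

  lifted∉run : ∀ {k} (v : Vec (Fin (suc m)) k) {y} → y ∈ map liftValue (values v) → y ∉ List.iterate suc 3 d
  lifted∉run v y∈ y∈R with ∈-iterate-suc y∈R | lifted-values-range v y∈
  ... | 3≤y , _     | inj₁ refl    = contradiction 3≤y λ { (s≤s (s≤s ())) }
  ... | _   , y<3+d | inj₂ 3+d≤y = contradiction y<3+d (≤⇒≯ 3+d≤y)

  1∉lifted : ∀ {k} (v : Vec (Fin (suc m)) k) → 1 ∉ map liftValue (values v)
  1∉lifted v 1∈ with lifted-values-range v 1∈
  ... | inj₂ (s≤s ())

  oneLine-insertRun-unique : ∀ w → Unique (oneLine w) → Unique (oneLine (insertRun w))
  oneLine-insertRun-unique w@(w₀ ∷ ws) u = subst Unique (sym (oneLine-insertRun w₀ ws))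
    (Unique-insert (List.iterate suc 3 d)
      (Unique-insert (1 ∷ []) (UniqueP.map⁺ (OrderEmbedding.injective liftValue-mono) u) ([] ∷ [])
        λ { (here refl) → 1∉lifted w })
      (iterate-suc-unique 3 d)
      λ y∈R → λ where
        (here refl)         → lifted∉run w (here refl) y∈R
        (there (here refl)) → contradiction (proj₁ (∈-iterate-suc y∈R)) λ { (s≤s ()) }
        (there (there y∈L)) → lifted∉run w (there y∈L) y∈R)

  module _ {w : Table (suc m)} (cyc : IsCyclic w) where

    private
      C′ : List ℕ
      C′ = orbit (lookup w) m (lookup w zero)

      C′-large : ∀ {c} → c ∈ C′ → 2 ≤ c
      C′-large {zero}        c∈ = contradiction c∈ (0∉orbit _ m _)
      C′-large {suc zero}    c∈ = contradiction c∈ (Cyclic.1∉cycle-tail cyc)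
      C′-large {suc (suc c)} _  = s≤s (s≤s z≤n)

      lifted-large : ∀ {y} → y ∈ map liftPoint C′ → 3 + d ≤ y
      lifted-large y∈ with c , c∈ , refl ← ∈-map⁻ liftPoint y∈ = liftPoint-large (C′-large c∈)

    cycleForm-insertRun-unique : Unique (cycleForm (insertRun w))
    cycleForm-insertRun-unique = subst Unique (sym (cycleForm-insertRun w cyc))
      (UniqueP.++⁺ (UniqueP.map⁺ (OrderEmbedding.injective liftPoint-mono) (IsCyclic.cycleForm-unique cyc))
                   (iterate-suc-unique 2 (suc d))
                   λ { (here refl , y∈I) → contradiction (proj₁ (∈-iterate-suc y∈I)) λ { (s≤s ()) }
                     ; (there y∈M , y∈I) → contradiction (proj₂ (∈-iterate-suc y∈I)) (≤⇒≯ (lifted-large y∈M)) })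

    cycleForm-insertRun-avoids-213 : ¬ Has213 (cycleForm w) → ¬ Has213 (cycleForm (insertRun w))
    cycleForm-insertRun-avoids-213 avoids =
      avoids ∘ Has213-⊆ (_ ∷ʳ ⊆-refl) ∘ OrderEmbedding.Has213-map⁻ liftPoint-mono C′
      ∘ Has213-remove (iterate-suc-increasing 2 (suc d)) I<M 1<MI ∘ subst Has213 (cycleForm-insertRun w cyc)
      where
      I<M : ∀ {y z} → y ∈ map liftPoint C′ → z ∈ List.iterate suc 2 (suc d) → z < y
      I<M y∈ z∈ = <-≤-trans (proj₂ (∈-iterate-suc z∈)) (lifted-large y∈)
      1<MI : All (1 <_) (map liftPoint C′ ++ List.iterate suc 2 (suc d))
      1<MI = AllP.++⁺ (All.tabulate λ y∈ → ≤-trans (s≤s (s≤s z≤n)) (lifted-large y∈))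
                      (All.tabulate λ z∈ → proj₁ (∈-iterate-suc z∈))

  deleteRun-insertRun : ∀ w → deleteRun (insertRun w) ≡ w
  deleteRun-insertRun w = trans (VecP.tabulate-cong λ i → trans (cong (restrict d) (lookup-insertRun-embedPoint w i))
                                                             (restrict-embedValue (lookup w i)))
                                (VecP.tabulate∘lookup w)

  embedValue-onto : ∀ x → x ≢ zero → (∀ t → x ≢ runValue t) → ∃[ j ] embedValue j ≡ x
  embedValue-onto x x≢0 x∉run with toℕ x in x≡
  ... | zero        = contradiction (Fin.toℕ-injective x≡) x≢0
  ... | suc zero    = zero , Fin.toℕ-injective (trans toℕ-one (sym x≡))
  ... | suc (suc s) with s <? d
  ...   | yes s<d = contradiction
    (Fin.toℕ-injective (trans x≡ (sym (trans (toℕ-runValue _) (cong (2 +_) (Fin.toℕ-fromℕ< s<d)))))) (x∉run _)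
  ...   | no  s≮d = suc (fromℕ< s∸d<m) , Fin.toℕ-injective (
      begin
        toℕ (suc d ↑ʳ suc (fromℕ< s∸d<m)) ≡⟨ Fin.toℕ-↑ʳ (suc d) _ ⟩
        suc d + suc (toℕ (fromℕ< s∸d<m))  ≡⟨ cong (λ z → suc d + suc z) (Fin.toℕ-fromℕ< s∸d<m) ⟩
        suc (d + suc (s ∸ d))              ≡⟨ cong suc (+-suc d (s ∸ d)) ⟩
        suc (suc (d + (s ∸ d)))            ≡⟨ cong (λ z → suc (suc z)) (m+[n∸m]≡n d≤s) ⟩
        suc (suc s)                        ≡⟨ sym x≡ ⟩
        toℕ x                              ∎)
    where
    open ≡-Reasoning
    d≤s : d ≤ s
    d≤s = ≮⇒≥ s≮d
    s∸d<m : s ∸ d < m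
    s∸d<m = +-cancelˡ-< d (s ∸ d) m (subst (_< d + m) (sym (m+[n∸m]≡n d≤s))
              (s<s⁻¹ (s<s⁻¹ (subst (suc (suc s) <_) (cong suc (+-suc d m)) (subst (_< N) x≡ (Fin.toℕ<n x))))))

  embedPoint≢ : ∀ i {p} → 1 ≤ toℕ p → toℕ p ≤ suc d → embedPoint i ≢ p
  embedPoint≢ zero    1≤p _     refl = contradiction 1≤p λ ()
  embedPoint≢ (suc i) _   p≤d+1 refl =
    contradiction (subst (_≤ suc d) (Fin.toℕ-↑ʳ (suc d) (suc i)) p≤d+1) (<⇒≱ (s≤s (m<m+n d z<s)))

  toℕ-runPoint : ∀ t → toℕ (runPoint t) ≡ suc (toℕ t)
  toℕ-runPoint t = cong suc (Fin.toℕ-↑ˡ t _)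

  toℕ-gapPoint : toℕ gapPoint ≡ suc d
  toℕ-gapPoint = cong suc (trans (Fin.toℕ-↑ʳ d zero) (+-identityʳ d))

  insertRun-deleteRun : ∀ π → (∀ {i j} → lookup π i ≡ lookup π j → i ≡ j) →
                        (∀ t → lookup π (runPoint t) ≡ runValue t) → lookup π gapPoint ≡ zero →
                        insertRun (deleteRun π) ≡ π
  insertRun-deleteRun π π-injective π-run π-gap =
    trans (sym (VecP.tabulate∘lookup _)) (trans (VecP.tabulate-cong agree) (VecP.tabulate∘lookup π))
    where
    onto : ∀ i → ∃[ j ] embedValue j ≡ lookup π (embedPoint i)
    onto i = embedValue-onto _
      (λ π≡0 → embedPoint≢ i (subst (1 ≤_) (sym toℕ-gapPoint) (s≤s z≤n)) (≤-reflexive toℕ-gapPoint)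
                 (π-injective (trans π≡0 (sym π-gap))))
      (λ t π≡run → embedPoint≢ i (subst (1 ≤_) (sym (toℕ-runPoint t)) (s≤s z≤n))
                     (subst (_≤ suc d) (sym (toℕ-runPoint t)) (s≤s (<⇒≤ (Fin.toℕ<n t))))
                     (π-injective (trans π≡run (sym (π-run t)))))
    agree-embedded : ∀ i → lookup (insertRun (deleteRun π)) (embedPoint i) ≡ lookup π (embedPoint i)
    agree-embedded i with j , j↦ ← onto i =
      begin
        lookup (insertRun (deleteRun π)) (embedPoint i) ≡⟨ lookup-insertRun-embedPoint (deleteRun π) i ⟩
        embedValue (lookup (deleteRun π) i)
          ≡⟨ cong embedValue (VecP.lookup∘tabulate (restrict d ∘ lookup π ∘ embedPoint) i) ⟩
        embedValue (restrict d (lookup π (embedPoint i))) ≡⟨ cong (embedValue ∘ restrict d) (sym j↦) ⟩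
        embedValue (restrict d (embedValue j))           ≡⟨ cong embedValue (restrict-embedValue j) ⟩
        embedValue j                                     ≡⟨ j↦ ⟩
        lookup π (embedPoint i)                          ∎
      where open ≡-Reasoning
    agree : ∀ p → lookup (insertRun (deleteRun π)) p ≡ lookup π p
    agree zero    = agree-embedded zero
    agree (suc q) with splitView d (suc m) q
    ... | left t        = trans (lookup-insertRun-runPoint (deleteRun π) t) (sym (π-run t))
    ... | right zero    = trans (lookup-insertRun-gapPoint (deleteRun π)) (sym π-gap)
    ... | right (suc i) = agree-embedded (suc i)

  insertRun-admissible : ∀ w → Admissible w → Admissible (insertRun w)
  insertRun-admissible w adm = record
    { cyclic = record
      { oneLine-unique   = oneLine-insertRun-unique w (IsCyclic.oneLine-unique cyclic)
      ; cycleForm-unique = cycleForm-insertRun-unique cyclic }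
    ; oneLine-avoids-4321  = oneLine-avoids-4321 ∘ Has4321-insertRun⁻ w
    ; cycleForm-avoids-213 = cycleForm-insertRun-avoids-213 cyclic cycleForm-avoids-213 }
    where open Admissible adm

  insertRun-admissible⁻ : ∀ w → Admissible (insertRun w) → Admissible w
  insertRun-admissible⁻ w adm = record
    { cyclic = record
      { oneLine-unique   = UniqueP.map⁻ (Unique-⊆ (oneLine-⊆ w) (IsCyclic.oneLine-unique cyclic))
      ; cycleForm-unique = UniqueP.map⁻ (Unique-⊆ (cycleForm-⊆ w cyclic) (IsCyclic.cycleForm-unique cyclic)) }
    ; oneLine-avoids-4321  = oneLine-avoids-4321 ∘ OrderEmbedding.Has4321-map liftValue-mono (oneLine-⊆ w)
    ; cycleForm-avoids-213 = cycleForm-avoids-213 ∘ OrderEmbedding.Has213-map liftPoint-mono (cycleForm-⊆ w cyclic) }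
    where open Admissible adm

  -- If m ≥ 1 and c_{m+2} = 2, then π is in the image of insertRun.
  module Structure {π : Table N} (adm : Admissible π) (1≤m : 1 ≤ m)
                   (reaches-2 : iterate (lookup π) zero (suc m) ≡ one) where

    open Admissible adm
    open Cyclic cyclic

    private
      val : ℕ → ℕ
      val i = toℕ (y i)

      val-2 : val (suc m) ≡ 1
      val-2 = trans (cong toℕ reaches-2) toℕ-one

      y-step : ∀ i → f (y i) ≡ y (suc i)
      y-step i = sym (iterate-suc f zero i)

      val-injective : ∀ {i j} → i < N → j < N → val i ≡ val j → i ≡ j
      val-injective i<N j<N e = y-injective i<N j<N (Fin.toℕ-injective e)

    before-2-large : ∀ {a} → 1 ≤ a → a < suc m → 1 < val a
    before-2-large {a} 1≤a a<m₀ with val a in val≡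
    ... | zero        = contradiction (val-injective (<-trans a<m₀ m+1<N) z<s val≡) (<⇒≢ 1≤a ∘ sym)
    ... | suc zero    = contradiction (val-injective (<-trans a<m₀ m+1<N) m+1<N (trans val≡ (sym val-2))) (<⇒≢ a<m₀)
    ... | suc (suc _) = s≤s (s≤s z≤n)

    after-2<before-2 : ∀ {a b} → 1 ≤ a → a < suc m → suc m < b → b < N → val b < val a
    after-2<before-2 {a} {b} 1≤a a<m₀ m₀<b b<N with <-cmp (val b) (val a)
    ... | tri< vb<va _ _ = vb<va
    ... | tri≈ _ vb≡va _ = contradiction (val-injective (<-trans a<m₀ m+1<N) b<N (sym vb≡va)) (<⇒≢ (<-trans a<m₀ m₀<b))
    ... | tri> _ _ va<vb = contradiction
      (_ , _ , _ , orbit-entries-⊆ f zero (a ∷ suc m ∷ b ∷ []) (a<m₀ ∷ m₀<b ∷ [-]) (<-trans a<m₀ m+1<N ∷ m+1<N ∷ b<N ∷ [])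
         , s≤s (subst (_< val a) (sym val-2) (before-2-large 1≤a a<m₀)) , s≤s (<⇒≤ va<vb))
      cycleForm-avoids-213

    Run : ℕ → Set
    Run t = ∀ {s} → s ≤ t → val (suc m + s) ≡ suc s

    Run-above : ∀ {t} → Run t → ∀ {p} → suc m + t < p → p < N → suc t < val p
    Run-above {t} run {p} beyond p<N with val p in val≡
    ... | zero  = contradiction (subst (suc m + t <_) (val-injective p<N z<s val≡) beyond) n≮0
    ... | suc s with t <? s
    ...   | yes t<s = s≤s t<s
    ...   | no  t≮s = contradiction (val-injective p<N (≤-<-trans (+-monoʳ-≤ (suc m) s≤t) (<-trans beyond p<N))
                                                   (trans val≡ (sym (run s≤t))))
                                    (λ p≡ → <⇒≱ beyond (subst (_≤ suc m + t) (sym p≡) (+-monoʳ-≤ (suc m) s≤t)))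
      where
      s≤t : s ≤ t
      s≤t = ≮⇒≥ t≮s

    module _ {t} (t<d : suc t ≤ d) (run : Run t) (skips : suc (suc t) < val (suc m + suc t)) where

      private
        m₁<N : suc m + suc t < N
        m₁<N = subst (suc m + suc t <_) (sym N≡) (+-monoʳ-< (suc m) (s≤s t<d))

        m₀<m₁ : suc m < suc m + suc t
        m₀<m₁ = m<m+n (suc m) z<s

        t+2<N : suc (suc t) < N
        t+2<N = <-trans skips (Fin.toℕ<n _)

        offset-beyond : ∀ {s} → val (suc m + s) ≡ suc (suc t) → suc t < s
        offset-beyond {s} val≡ with <-cmp s (suc t)
        ... | tri< s<t+1 _ _ = contradiction (suc-injective (trans (sym (run (s≤s⁻¹ s<t+1))) val≡)) (<⇒≢ s<t+1)
        ... | tri≈ _ refl _  = contradiction val≡ (<⇒≢ skips ∘ sym)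
        ... | tri> _ _ t+1<s = t+1<s

      next-beyond : ∀ {p} → p < N → val p ≡ suc (suc t) → suc m + suc t < p
      next-beyond {zero}  _   ()
      next-beyond {suc p} p<N val≡ with suc p <? suc m
      ... | yes p<m₀ = contradiction (subst (val (suc m + suc t) <_) val≡ (after-2<before-2 (s≤s z≤n) p<m₀ m₀<m₁ m₁<N))
                                     (<-asym skips)
      ... | no  p≮m₀ = subst (suc m + suc t <_) split (+-monoʳ-< (suc m) (offset-beyond (trans (cong val split) val≡)))
        where
        split : suc m + (suc p ∸ suc m) ≡ suc p
        split = m+[n∸m]≡n (≮⇒≥ p≮m₀)

      -- If c_{p+2} = t+3 with p ≥ m+t+2, the entries of π at the positions 1 < t+2 < c_{p+1} < c_{m+1}
      -- are c_2 > c_{m+t+3} > t+3 > 2.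
      skip⇒4321 : ∀ {p} → suc m + suc t ≤ p → suc p < N → val (suc p) ≡ suc (suc t) → Has4321 (oneLine π)
      skip⇒4321 {p} m₁≤p p+1<N val≡ =
        _ , _ , _ , _ , values-entries-⊆ π (zero ∷ P ∷ Q ∷ Z ∷ []) (0<P ∷ P<Q ∷ Q<Z ∷ [-]) , fP<f0 , fQ<fP , fZ<fQ
        where
        P Q Z : Fin N
        P = y (suc m + t)
        Q = y p
        Z = y m
        p<N : p < N
        p<N = <-trans (n<1+n p) p+1<N
        toℕP : toℕ P ≡ suc t
        toℕP = run ≤-refl
        0<P : 0 < toℕ P
        0<P = subst (0 <_) (sym toℕP) z<s
        P<Q : toℕ P < toℕ Q
        P<Q = subst (_< val p) (sym toℕP) (Run-above run (<-≤-trans (+-monoʳ-< (suc m) (n<1+n t)) m₁≤p) p<N)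
        Q<Z : toℕ Q < toℕ Z
        Q<Z = after-2<before-2 1≤m (n<1+n m) (<-≤-trans m₀<m₁ m₁≤p) p<N
        fP≡ : toℕ (f P) ≡ val (suc m + suc t)
        fP≡ = cong toℕ (trans (y-step (suc m + t)) (cong y (sym (+-suc (suc m) t))))
        fQ≡ : toℕ (f Q) ≡ suc (suc t)
        fQ≡ = trans (cong toℕ (y-step p)) val≡
        fP<f0 : suc (toℕ (f P)) < suc (toℕ (f zero))
        fP<f0 = s≤s (subst (_< val 1) (sym fP≡) (after-2<before-2 ≤-refl (s≤s 1≤m) m₀<m₁ m₁<N))
        fQ<fP : suc (toℕ (f Q)) < suc (toℕ (f P))
        fQ<fP = s≤s (subst₂ _<_ (sym fQ≡) (sym fP≡) skips)
        fZ<fQ : suc (toℕ (f Z)) < suc (toℕ (f Q))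
        fZ<fQ = s≤s (subst₂ _<_ (sym (trans (cong toℕ (y-step m)) val-2)) (sym fQ≡) (s≤s (s≤s z≤n)))

      skip-impossible : ⊥
      skip-impossible with p , p<N , yp≡X ← y-surjective (fromℕ< t+2<N) =
        go p<N (trans (cong toℕ yp≡X) (Fin.toℕ-fromℕ< t+2<N))
        where
        go : ∀ {p} → p < N → val p ≡ suc (suc t) → ⊥
        go {zero}   _   ()
        go {suc p₀} p<N val≡ = oneLine-avoids-4321 (skip⇒4321 (s≤s⁻¹ (next-beyond p<N val≡)) p<N val≡)

    Run-step : ∀ {t} → suc t ≤ d → Run t → Run (suc t)
    Run-step {t} t<d run {s} s≤t+1 with m≤n⇒m<n∨m≡n s≤t+1
    ... | inj₁ s<t+1 = run (s≤s⁻¹ s<t+1)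
    ... | inj₂ refl  = ≤-antisym (≮⇒≥ (skip-impossible t<d run))
      (Run-above run (+-monoʳ-< (suc m) (n<1+n t)) (subst (suc m + suc t <_) (sym N≡) (+-monoʳ-< (suc m) (s≤s t<d))))

    run-after-2 : ∀ t → t ≤ d → Run t
    run-after-2 zero    _   z≤n = trans (cong val (+-identityʳ (suc m))) val-2
    run-after-2 (suc t) t<d     = Run-step t<d (run-after-2 t (<⇒≤ t<d))

    private
      point-after-2 : ∀ {p s} → s ≤ d → toℕ p ≡ suc s → p ≡ y (suc m + s)
      point-after-2 s≤d p≡ = Fin.toℕ-injective (trans p≡ (sym (run-after-2 d ≤-refl s≤d)))

    π-run : ∀ t → lookup π (runPoint t) ≡ runValue t
    π-run t = Fin.toℕ-injective (
      begin
        toℕ (f (runPoint t))        ≡⟨ cong (toℕ ∘ f) (point-after-2 (<⇒≤ (Fin.toℕ<n t)) (toℕ-runPoint t)) ⟩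
        toℕ (f (y (suc m + toℕ t))) ≡⟨ cong toℕ (y-step (suc m + toℕ t)) ⟩
        val (suc (suc m + toℕ t))   ≡⟨ cong val (sym (+-suc (suc m) (toℕ t))) ⟩
        val (suc m + suc (toℕ t))   ≡⟨ run-after-2 d ≤-refl (Fin.toℕ<n t) ⟩
        suc (suc (toℕ t))           ≡⟨ sym (toℕ-runValue t) ⟩
        toℕ (runValue t)            ∎)
      where open ≡-Reasoning

    π-gap : lookup π gapPoint ≡ zero
    π-gap =
      begin
        f gapPoint          ≡⟨ cong f (point-after-2 ≤-refl toℕ-gapPoint) ⟩
        f (y (suc m + d))   ≡⟨ y-step (suc m + d) ⟩
        y (suc (suc m + d)) ≡⟨ cong y (trans (sym (+-suc (suc m) d)) (sym N≡)) ⟩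
        y N                 ≡⟨ y-closes ⟩
        zero                ∎
      where open ≡-Reasoning

    in-image : insertRun (deleteRun π) ≡ π
    in-image = insertRun-deleteRun π f-injective π-run π-gap

-- Merging the points 1 and 2

merge01 : ∀ {k} → Fin (suc (suc k)) → Fin (suc k)
merge01 zero    = zero
merge01 (suc x) = x

collapse : ∀ {k} → Table (suc (suc k)) → Table (suc k)
collapse (_ ∷ xs) = Vec.map merge01 xs

skip2 : ℕ → ℕ
skip2 (suc (suc y)) = suc (suc (suc y))
skip2 y             = y

skip2-mono : skip2 Preserves _<_ ⟶ _<_
skip2-mono {zero}        {suc zero}    _        = z<s
skip2-mono {zero}        {suc (suc y)} _        = z<s
skip2-mono {suc zero}    {suc zero}    (s≤s ())
skip2-mono {suc zero}    {suc (suc y)} _        = s≤s (s≤s z≤n)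
skip2-mono {suc (suc x)} {suc zero}    (s≤s ())
skip2-mono {suc (suc x)} {suc (suc y)} x<y      = s≤s x<y

values-collapse : ∀ {k l} (xs : Vec (Fin (suc (suc k))) l) → (∀ i → lookup xs i ≢ suc zero) →
                  values xs ≡ map skip2 (values (Vec.map merge01 xs))
values-collapse []                  _   = refl
values-collapse (zero        ∷ xs) ≢1 = cong (1 ∷_) (values-collapse xs (≢1 ∘ suc))
values-collapse (suc zero    ∷ xs) ≢1 = contradiction refl (≢1 zero)
values-collapse (suc (suc x) ∷ xs) ≢1 = cong (suc (suc (suc (toℕ x))) ∷_) (values-collapse xs (≢1 ∘ suc))

-- If π(1) = 2, the cycle (1, 2, c_3, …, c_n) of π becomes (1, c_3-1, …, c_n-1) in collapse π.
module Collapse {k} {x : Fin (suc (suc k))} {xs : Vec (Fin (suc (suc k))) (suc k)}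
                (cyc : IsCyclic (x ∷ xs)) (x≡1 : x ≡ suc zero) where

  private
    π : Table (suc (suc k))
    π = x ∷ xs
    f : Fin (suc (suc k)) → Fin (suc (suc k))
    f = lookup π
    g : Fin (suc k) → Fin (suc k)
    g = lookup (collapse π)
    open Cyclic cyc using (f-injective)

  oneLine-collapse : oneLine π ≡ 2 ∷ map skip2 (oneLine (collapse π))
  oneLine-collapse = cong₂ _∷_ (cong (suc ∘ toℕ) x≡1)
    (values-collapse xs λ i xsᵢ≡1 → contradiction (f-injective {suc i} {zero} (trans xsᵢ≡1 (sym x≡1))) λ ())

  orbit-collapse : ∀ l i → 1 ∉ orbit f (suc l) (suc i) → orbit f (suc l) (suc i) ≡ map suc (orbit g (suc l) i)
  orbit-collapse zero    i _  = refl
  orbit-collapse (suc l) i 1∉ with lookup xs i in f≡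
  ... | zero  = contradiction (there (here refl)) 1∉
  ... | suc j = cong (suc (suc (toℕ i)) ∷_)
    (trans (orbit-collapse l j (1∉ ∘ there))
           (cong (map suc ∘ orbit g (suc l)) (sym (trans (VecP.lookup-map i merge01 xs) (cong merge01 f≡)))))

  cycleForm-collapse : cycleForm π ≡ 1 ∷ map suc (cycleForm (collapse π))
  cycleForm-collapse = cong (1 ∷_) (trans (cong (orbit f (suc k)) x≡1) (orbit-collapse k zero 1∉))
    where
    1∉ : 1 ∉ orbit f (suc k) (suc zero)
    1∉ = subst (λ z → 1 ∉ orbit f (suc k) z) x≡1 (Cyclic.1∉cycle-tail cyc)

  private
    Unique-tail : ∀ {y : ℕ} {ys} → Unique (y ∷ ys) → Unique ys
    Unique-tail (_ ∷ u) = u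

  collapse-admissible : Admissible π → Admissible (collapse π)
  collapse-admissible adm = record
    { cyclic = record
      { oneLine-unique   = UniqueP.map⁻ (Unique-tail (subst Unique oneLine-collapse (IsCyclic.oneLine-unique cyclic)))
      ; cycleForm-unique = UniqueP.map⁻ (Unique-tail (subst Unique cycleForm-collapse (IsCyclic.cycleForm-unique cyclic))) }
    ; oneLine-avoids-4321  = oneLine-avoids-4321 ∘ OrderEmbedding.Has4321-map skip2-mono
                               (⊆-trans (2 ∷ʳ ⊆-refl) (⊆-reflexive (sym oneLine-collapse)))
    ; cycleForm-avoids-213 = cycleForm-avoids-213 ∘ OrderEmbedding.Has213-map s≤s
                               (⊆-trans (1 ∷ʳ ⊆-refl) (⊆-reflexive (sym cycleForm-collapse))) }
    where open Admissible adm

  Has··21-collapse : Has··21 (oneLine π) → Has··21 (oneLine (collapse π))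
  Has··21-collapse h with subst Has··21 oneLine-collapse h
  ... | a , b , c , d , _ ∷ʳ abcd⊆ , c<a , c<b , d<c =
    OrderEmbedding.Has··21-map⁻ skip2-mono _ (a , b , c , d , abcd⊆ , c<a , c<b , d<c)
  ... | a , b , c , d , refl ∷ bcd⊆ , c<2 , _ , d<c with ∈-map⁻ skip2 (to∈ (∷ˡ⁻ (∷ˡ⁻ bcd⊆)))
  ...   | zero  , 0∈ , _ = contradiction 0∈ (0∉values (collapse π))
  ...   | suc e , _  , d≡ = contradiction (<-≤-trans (subst (_< c) d≡ d<c) (s≤s⁻¹ c<2)) (skip2-pos e)
    where
    skip2-pos : ∀ e → ¬ skip2 (suc e) < 1
    skip2-pos zero    (s≤s ())
    skip2-pos (suc e) (s≤s ())

-- Avoidance of 3421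

module _ {m d : ℕ} where
  open Insertion m d

  deleteRun-admissible : ∀ {π : Table N} → Admissible π → 1 ≤ m → iterate (lookup π) zero (suc m) ≡ one →
                         Admissible (deleteRun π)
  deleteRun-admissible adm 1≤m reaches-2 =
    insertRun-admissible⁻ _ (subst Admissible (sym (Structure.in-image adm 1≤m reaches-2)) adm)

  Has··21-deleteRun : ∀ {π : Table N} → Admissible π → 1 ≤ m → iterate (lookup π) zero (suc m) ≡ one →
                      Has··21 (oneLine π) → Has··21 (oneLine (deleteRun π))
  Has··21-deleteRun adm 1≤m reaches-2 =
    Has··21-insertRun⁻ _ ∘ subst (Has··21 ∘ oneLine) (sym (Structure.in-image adm 1≤m reaches-2))

private
  Has··21-shrink : ∀ {n} m d → suc n ≡ Insertion.N m d → (π : Table (suc n)) → Admissible π → 1 ≤ m →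
                   toℕ (iterate (lookup π) zero (suc m)) ≡ 1 → Has··21 (oneLine π) →
                   ∃[ w ] Admissible w × Has··21 (oneLine {suc m} w)
  Has··21-shrink m d refl π adm 1≤m val-2 occ =
    deleteRun π , deleteRun-admissible adm 1≤m reaches-2 , Has··21-deleteRun adm 1≤m reaches-2 occ
    where
    open Insertion m d
    reaches-2 : iterate (lookup π) zero (suc m) ≡ one
    reaches-2 = Fin.toℕ-injective (trans val-2 (sym toℕ-one))

admissible⇒avoids··21 : ∀ {n} (π : Table n) → Admissible π → ¬ Has··21 (oneLine π)
admissible⇒avoids··21 {n} = <-rec (λ n → (π : Table n) → Admissible π → ¬ Has··21 (oneLine π)) step n
  where
  step : ∀ n → (∀ {k} → k < n → (π : Table k) → Admissible π → ¬ Has··21 (oneLine π)) →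
         (π : Table n) → Admissible π → ¬ Has··21 (oneLine π)
  step zero          _   []        _   (_ , _ , _ , _ , () , _)
  step (suc zero)    _   (_ ∷ [])  _   (_ , _ , _ , _ , _ ∷ʳ () , _)
  step (suc zero)    _   (_ ∷ [])  _   (_ , _ , _ , _ , refl ∷ () , _)
  step (suc (suc k)) rec π@(x ∷ xs) adm occ with Cyclic.y-surjective (Admissible.cyclic adm) (suc zero)
  ... | zero        , _   , ()
  ... | suc zero    , _   , x≡1 =
    rec ≤-refl (collapse π) (Collapse.collapse-admissible cyclic x≡1 adm) (Collapse.Has··21-collapse cyclic x≡1 occ)
    where open Admissible adm using (cyclic)
  ... | suc (suc m) , p<n , y≡1
    with w , adm′ , occ′ ← Has··21-shrink (suc m) (suc k ∸ suc (suc m)) (cong suc (sym (m∸n+n≡m (s≤s⁻¹ p<n))))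
                                         π adm (s≤s z≤n) (cong toℕ y≡1) occ
    = rec p<n w adm′ occ′

-- The bijection

lastTwo : ∀ (xs : List ℕ) → 2 ≤ length xs → ∃[ pre ] ∃[ a ] ∃[ b ] xs ≡ pre ++ a ∷ b ∷ []
lastTwo (a ∷ [])         (s≤s ())
lastTwo (a ∷ b ∷ [])     _ = [] , a , b , refl
lastTwo (a ∷ b ∷ c ∷ xs) _ with pre , x , y , eq ← lastTwo (b ∷ c ∷ xs) (s≤s (s≤s z≤n)) =
  a ∷ pre , x , y , cong (a ∷_) eq

permutation-ends-in-··21 : ∀ k τ → 4 ≤ k → length τ ≡ k → τ ↭ map suc (upTo k) →
                          ∃[ τ′ ] τ ≡ τ′ ++ 2 ∷ 1 ∷ [] → EndsIn··21 τ
permutation-ends-in-··21 k τ 4≤k |τ|≡k τ↭ (τ′ , refl)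
  with pre , t₁ , t₂ , refl ← lastTwo τ′ (+-cancelʳ-≤ 2 2 (length τ′)
                                 (subst (4 ≤_) (trans (sym |τ|≡k) (List.length-++ τ′)) 4≤k))
  = pre , t₁ , t₂ , τ≡
  , above-2 (positive (∈-++⁺ʳ pre (here refl))) (head≢ (here refl)) (head≢ (there (here refl)))
  , above-2 (positive (∈-++⁺ʳ pre (there (here refl)))) (second≢ (here refl)) (second≢ (there (here refl)))
  where
  τ≡ : (pre ++ t₁ ∷ t₂ ∷ []) ++ 2 ∷ 1 ∷ [] ≡ pre ++ t₁ ∷ t₂ ∷ 2 ∷ 1 ∷ []
  τ≡ = List.++-assoc pre (t₁ ∷ t₂ ∷ []) (2 ∷ 1 ∷ [])
  τ-unique : Unique ((pre ++ t₁ ∷ t₂ ∷ []) ++ 2 ∷ 1 ∷ [])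
  τ-unique = PermutationₛP.Unique-resp-↭ (≡.setoid ℕ) (↭⇒↭ₛ (↭-sym τ↭)) (UniqueP.map⁺ suc-injective (UniqueP.upTo⁺ k))
  suffix-unique : Unique (t₁ ∷ t₂ ∷ 2 ∷ 1 ∷ [])
  suffix-unique = Unique-⊆ (++⁺ˡ pre ⊆-refl) (subst Unique τ≡ τ-unique)
  head≢ : ∀ {x} → x ∈ 1 ∷ 2 ∷ [] → t₁ ≢ x
  head≢ x∈ with (_ ∷ t₁≢2 ∷ t₁≢1 ∷ []) ∷ _ ← suffix-unique with x∈
  ... | here refl         = t₁≢1
  ... | there (here refl) = t₁≢2
  second≢ : ∀ {x} → x ∈ 1 ∷ 2 ∷ [] → t₂ ≢ x
  second≢ x∈ with _ ∷ (t₂≢2 ∷ t₂≢1 ∷ []) ∷ _ ← suffix-unique with x∈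
  ... | here refl         = t₂≢1
  ... | there (here refl) = t₂≢2
  positive : ∀ {t} → t ∈ pre ++ t₁ ∷ t₂ ∷ 2 ∷ 1 ∷ [] → t ≢ 0
  positive t∈ with _ , _ , refl ← ∈-map⁻ suc (PermutationP.∈-resp-↭ τ↭ (subst (_ ∈_) (sym τ≡) t∈)) = λ ()
  above-2 : ∀ {t} → t ≢ 0 → t ≢ 1 → t ≢ 2 → 2 < t
  above-2 {zero}                t≢0 _   _   = contradiction refl t≢0
  above-2 {suc zero}            _   t≢1 _   = contradiction refl t≢1
  above-2 {suc (suc zero)}      _   _   t≢2 = contradiction refl t≢2
  above-2 {suc (suc (suc t))}   _   _   _   = s≤s (s≤s (s≤s z≤n))

module _ {τ : List ℕ} (τ-shape : EndsIn··21 τ) where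

  private
    inA-parts : ∀ {n} (π : Table n) → T (inA (τ ∷ (4 ∷ 3 ∷ 2 ∷ 1 ∷ []) ∷ []) (2 ∷ 1 ∷ 3 ∷ []) π) →
                T (isCyclicPerm π) × T (avoids (oneLine π) (4 ∷ 3 ∷ 2 ∷ 1 ∷ [])) × T (avoids (cycleForm π) (2 ∷ 1 ∷ 3 ∷ []))
    inA-parts π h with cyclic , avoiding ← to T-∧ h
                  with avoidsσ , avoids213 ← to T-∧ avoiding
                  with _ ∷ avoids4321 ∷ [] ← AllP.all⁺ (avoids (oneLine π)) (τ ∷ (4 ∷ 3 ∷ 2 ∷ 1 ∷ []) ∷ []) avoidsσ
      = cyclic , avoids4321 , avoids213

  inA⇔Admissible : ∀ {n} (π : Table n) → T (inA (τ ∷ (4 ∷ 3 ∷ 2 ∷ 1 ∷ []) ∷ []) (2 ∷ 1 ∷ 3 ∷ []) π) ⇔ Admissible π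
  inA⇔Admissible π = mk⇔
    (λ h → let (cyclic , avoids4321 , avoids213) = inA-parts π h
           in record { cyclic               = to (isCyclicPerm⇔ π) cyclic
                     ; oneLine-avoids-4321  = T-not⇒¬T avoids4321 ∘ from (contains4321⇔ (oneLine π))
                     ; cycleForm-avoids-213 = T-not⇒¬T avoids213 ∘ from (contains213⇔ (cycleForm π)) })
    (λ adm → let open Admissible adm in
      from (isCyclicPerm⇔ π) cyclic
      & (AllP.all⁻ (avoids (oneLine π)) {xs = τ ∷ (4 ∷ 3 ∷ 2 ∷ 1 ∷ []) ∷ []}
           (¬T⇒T-not (admissible⇒avoids··21 π adm ∘ contains-··21 τ-shape (oneLine π))
            ∷ ¬T⇒T-not (oneLine-avoids-4321 ∘ to (contains4321⇔ (oneLine π))) ∷ [])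
         & ¬T⇒T-not (cycleForm-avoids-213 ∘ to (contains213⇔ (cycleForm π)))))

  module _ {m d : ℕ} (1≤m : 1 ≤ m) where
    open Insertion m d

    private
      σs : List (List ℕ)
      σs = τ ∷ (4 ∷ 3 ∷ 2 ∷ 1 ∷ []) ∷ []
      ρ : List ℕ
      ρ = 2 ∷ 1 ∷ 3 ∷ []

      Σ-T-≡ : ∀ {k} {P : Table k → Bool} {π π′ : Table k} {p : T (P π)} {p′ : T (P π′)} →
              π ≡ π′ → _≡_ {A = Σ (Table k) (T ∘ P)} (π , p) (π′ , p′)
      Σ-T-≡ refl = cong (_ ,_) (T-irrelevant _ _)

      reaches-2 : ∀ {π : Table N} → T (nth (cycleForm π) (suc (suc m)) ≡ᵇ 2) → iterate (lookup π) zero (suc m) ≡ one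
      reaches-2 {π} h = Fin.toℕ-injective
        (trans (suc-injective (trans (sym (nth-orbit (lookup π) zero m+1<N)) (≡ᵇ⇒≡ _ 2 h))) (sym toℕ-one))

      admissible : ∀ {π : Table N} → T (inA σs ρ π ∧ (nth (cycleForm π) (suc (suc m)) ≡ᵇ 2)) → Admissible π
      admissible {π} h = to (inA⇔Admissible π) (proj₁ (to T-∧ h))

      shrink : A∣ N σs ρ (suc (suc m)) → A (suc m) σs ρ
      shrink (π , h) = deleteRun π , from (inA⇔Admissible (deleteRun π))
        (deleteRun-admissible {π = π} (admissible {π} h) 1≤m (reaches-2 {π} (proj₂ (to T-∧ h))))

      extend : A (suc m) σs ρ → A∣ N σs ρ (suc (suc m))
      extend (w , h) = insertRun w , (from (inA⇔Admissible (insertRun w)) (insertRun-admissible w adm)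
                                      & ≡⇒≡ᵇ _ 2 (nth-cycleForm-insertRun w (Admissible.cyclic adm)))
        where
        adm : Admissible w
        adm = to (inA⇔Admissible w) h

      shrink∘extend : ∀ w → shrink (extend w) ≡ w
      shrink∘extend (w , _) = Σ-T-≡ (deleteRun-insertRun w)

      extend∘shrink : ∀ π → extend (shrink π) ≡ π
      extend∘shrink (π , h) = Σ-T-≡ (Structure.in-image {π = π} (admissible {π} h) 1≤m (reaches-2 {π} (proj₂ (to T-∧ h))))

    A∣↔A : A∣ N σs ρ (suc (suc m)) ↔ A (suc m) σs ρ
    A∣↔A = mk↔ₛ′ shrink extend shrink∘extend extend∘shrink

resize : ∀ {n N : ℕ} {σs ρ j} {B : Set} → n ≡ N → (A∣ N σs ρ j ↔ B) → A∣ n σs ρ j ↔ B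
resize refl bijection = bijection

lemma3p2 : (n k j : ℕ) (τ : List ℕ)
    → 5 ≤ n → 4 ≤ k
    → length τ ≡ k
    → τ ↭ map suc (upTo k)
    → ∃ (λ τ′ → τ ≡ τ′ ++ (2 ∷ 1 ∷ []))
    → 3 ≤ j → j ≤ n
    → A∣ n (τ ∷ (4 ∷ 3 ∷ 2 ∷ 1 ∷ []) ∷ []) (2 ∷ 1 ∷ 3 ∷ []) j
      ↔ A (j ∸ 1) (τ ∷ (4 ∷ 3 ∷ 2 ∷ 1 ∷ []) ∷ []) (2 ∷ 1 ∷ 3 ∷ [])
lemma3p2 n k j@(suc (suc (suc m))) τ _ 4≤k |τ|≡k τ↭ ends-in-21 (s≤s (s≤s (s≤s _))) j≤n =
  resize {σs = τ ∷ (4 ∷ 3 ∷ 2 ∷ 1 ∷ []) ∷ []} {2 ∷ 1 ∷ 3 ∷ []} n≡N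
         (A∣↔A (permutation-ends-in-··21 k τ 4≤k |τ|≡k τ↭ ends-in-21) {d = n ∸ j} (s≤s z≤n))
  where
  n≡N : n ≡ suc (n ∸ j + suc (suc m))
  n≡N = trans (sym (m∸n+n≡m j≤n)) (+-suc (n ∸ j) (suc (suc m)))
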